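{- Let $\mathcal{L}$ be one of the logics $\mathsf{M5},\mathsf{MP5},\mathsf{M45},\mathsf{MP45},\mathsf{MD45},\mathsf{K45},\mathsf{KD45}$. Then the linear nested sequent calculus $\mathsf{LNS}_{\mathcal{L}}$ extended with contraction and weakening is sound and complete for $\mathcal{L}$: for every formula $A$, $A\in\mathcal{L}$ if and only if $\;\Rightarrow A$ is derivable in this calculus.
   Context: Formulas: propositional variables, $\bot,\top,\neg,\land,\lor,\to,\Box$. For a set $\mathcal{A}$ of axiom names, $\mathsf{M}\mathcal{A}$ is the smallest set of formulas containing all propositional tautologies, the axiom $\Box(A\land B)\to(\Box A\land\Box B)$ and the axioms in $\mathcal{A}$, closed under modus ponens and the rule: from $A\to B$ and $B\to A$ infer $\Box A\to\Box B$; axioms: $\mathsf{C}: (\Box A\land\Box B)\to\Box(A\land B)$, $\mathsf{N}: \Box\top$, $\mathsf{P}: \neg\Box\bot$, $\mathsf{D}: \neg(\Box A\land\Box\neg A)$, $\mathsf{4}: \Box A\to\Box\Box A$, $\mathsf{5}: \Box A\lor\Box\neg\Box A$. The logics are $\mathsf{M5}=\mathsf{M}\{\mathsf 5\}$, $\mathsf{MP5}=\mathsf{M}\{\mathsf P,\mathsf 5\}$, $\mathsf{M45}=\mathsf{M}\{\mathsf 4,\mathsf 5\}$, $\mathsf{MP45}=\mathsf{M}\{\mathsf P,\mathsf 4,\mathsf 5\}$, $\mathsf{MD45}=\mathsf{M}\{\mathsf D,\mathsf 4,\mathsf 5\}$, $\mathsf{K45}=\mathsf{M}\{\mathsf N,\mathsf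 C,\mathsf 4,\mathsf 5\}$, $\mathsf{KD45}=\mathsf{M}\{\mathsf N,\mathsf C,\mathsf D,\mathsf 4,\mathsf 5\}$; $\mathsf{LNS}_{\mathcal{L}}$ for $\mathcal{L}=\mathsf{M}\mathcal{A}$ is the calculus with rules $\Box^{\mathsf m}_R,\Box^{\mathsf m}_L$ and the rules named by the elements of $\mathcal{A}$. Structures: $\mathcal{X}::=\Gamma\Rightarrow\Delta\mid\Gamma\Rightarrow\Delta\,/_{\mathsf m}\,\Sigma\Rightarrow\Pi\mid\Gamma\Rightarrow\Delta\,/\,\mathcal{X}$ (finite multisets; $/_{\mathsf m}$ only at the end). $\mathcal{S}\{\cdot\}$ marks a component; in rules below displayed components are the last ones and $\mathcal{G}$ is a possibly empty prefix. Propositional rules: zero-premiss $\mathcal{S}\{\Gamma,p\Rightarrow p,\Delta\}$ ($p$ atomic), $\mathcal{S}\{\Gamma,\bot\Rightarrow\Delta\}$, $\mathcal{S}\{\Gamma\Rightarrow\top,\Delta\}$ and the standard two-sided invertible rules for $\neg,\land,\lor,\to$ on one component, not applicable to the component after $/_{\mathsf m}$. $\Box^{\mathsf m}_R$: $\mathcal{G}/\Gamma\Rightarrow\Delta/_{\mathsf m}\Rightarrow B$ / $\mathcal{G}/\Gamma\Rightarrow\Box B,\Delta$; $\Box^{\mathsf m}_L$: $\mathcal{G}/\Gamma\Rightarrow\Delta/\Sigma,A\Rightarrow\Pi$ / $\mathcal{G}/\Gamma,\Box A\Rightarrow\Delta/_{\mathsf m}\Sigma\Rightarrow\Pi$; $\mathsf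 C$: $\mathcal{G}/_{\mathsf m}\Gamma\Rightarrow\Delta$ / $\mathcal{G}/\Gamma\Rightarrow\Delta$; $\mathsf N$: $\mathcal{G}/\Gamma\Rightarrow\Delta$ / $\mathcal{G}/_{\mathsf m}\Gamma\Rightarrow\Delta$; $\mathsf P$: $\mathcal{G}/\Gamma\Rightarrow\Delta/_{\mathsf m}\Rightarrow$ / $\mathcal{G}/\Gamma\Rightarrow\Delta$; $\mathsf D$: $\mathcal{G}/\Gamma\Rightarrow\Delta/_{\mathsf m}A\Rightarrow$ / $\mathcal{G}/\Gamma,\Box A\Rightarrow\Delta$; $\mathsf 4$: $\mathcal{G}/\Gamma\Rightarrow\Delta/\Sigma,\Box A\Rightarrow\Pi$ / $\mathcal{G}/\Gamma,\Box A\Rightarrow\Delta/_{\mathsf m}\Sigma\Rightarrow\Pi$; $\mathsf 5$: $\mathcal{G}/\Gamma\Rightarrow\Delta/\Sigma\Rightarrow\Pi,\Box A$ / $\mathcal{G}/\Gamma\Rightarrow\Delta,\Box A/_{\mathsf m}\Sigma\Rightarrow\Pi$. Contraction and weakening: usual left/right rules inside a component. -}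

module Defs where

open import Data.Nat using (ℕ)
open import Data.Bool using (Bool; true; false; not; _∧_; _∨_)
open import Data.List using (List; []; _∷_; _++_; [_])
open import Data.List.Membership.Propositional using (_∈_)
open import Data.List.Relation.Binary.Permutation.Propositional using (_↭_)
open import Data.Maybe using (Maybe; just; nothing)
open import Data.Product using (_×_)
open import Relation.Binary.PropositionalEquality using (_≡_)

infixr 8 _∧ᶠ_
infixr 7 _∨ᶠ_
infixr 6 _→ᶠ_
infix 9 □_ ¬ᶠ_

data Fm : Set where
  var   : ℕ → Fm
  ⊥ᶠ ⊤ᶠ : Fm
  ¬ᶠ_   : Fm → Fm
  _∧ᶠ_ _∨ᶠ_ _→ᶠ_ : Fm → Fm → Fm
  □_    : Fm → Fm

-- Propositional tautologies: formulas true under every classical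
-- valuation in which propositional variables and boxed formulas are atoms.

eval : (Fm → Bool) → Fm → Bool
eval v (var p)  = v (var p)
eval v ⊥ᶠ       = false
eval v ⊤ᶠ       = true
eval v (¬ᶠ A)   = not (eval v A)
eval v (A ∧ᶠ B) = eval v A ∧ eval v B
eval v (A ∨ᶠ B) = eval v A ∨ eval v B
eval v (A →ᶠ B) = not (eval v A) ∨ eval v B
eval v (□ A)    = v (□ A)

Tautology : Fm → Set
Tautology A = (v : Fm → Bool) → eval v A ≡ true

data AxName : Set where
  C N P D ax4 ax5 : AxName

data AxInst : AxName → Fm → Set where
  instC : ∀ A B → AxInst C ((□ A ∧ᶠ □ B) →ᶠ □ (A ∧ᶠ B))
  instN : AxInst N (□ ⊤ᶠ)
  instP : AxInst P (¬ᶠ (□ ⊥ᶠ))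
  instD : ∀ A → AxInst D (¬ᶠ (□ A ∧ᶠ □ (¬ᶠ A)))
  inst4 : ∀ A → AxInst ax4 (□ A →ᶠ □ (□ A))
  inst5 : ∀ A → AxInst ax5 (□ A ∨ᶠ □ (¬ᶠ (□ A)))

data Logic : Set where
  M5 MP5 M45 MP45 MD45 K45 KD45 : Logic

-- the set 𝒜 of axiom names with ℒ = M𝒜
axioms : Logic → List AxName
axioms M5   = ax5 ∷ []
axioms MP5  = P ∷ ax5 ∷ []
axioms M45  = ax4 ∷ ax5 ∷ []
axioms MP45 = P ∷ ax4 ∷ ax5 ∷ []
axioms MD45 = D ∷ ax4 ∷ ax5 ∷ []
axioms K45  = N ∷ C ∷ ax4 ∷ ax5 ∷ []
axioms KD45 = N ∷ C ∷ D ∷ ax4 ∷ ax5 ∷ []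

data _⊢H_ (L : Logic) : Fm → Set where
  taut : ∀ {A} → Tautology A → L ⊢H A
  axM  : ∀ A B → L ⊢H (□ (A ∧ᶠ B) →ᶠ (□ A ∧ᶠ □ B))
  ax   : ∀ {a A} → a ∈ axioms L → AxInst a A → L ⊢H A
  mp   : ∀ {A B} → L ⊢H (A →ᶠ B) → L ⊢H A → L ⊢H B
  re   : ∀ {A B} → L ⊢H (A →ᶠ B) → L ⊢H (B →ᶠ A) → L ⊢H (□ A →ᶠ □ B)

-- Linear nested sequents
-- Multisets are represented by lists together with exchange rules.

infix 3 _⇒_
record Comp : Set where
  constructor _⇒_
  field
    ant : List Fm
    suc : List Fm

-- A structure  G₁ / … / Gₙ / Γ⇒Δ  [ /ₘ Σ⇒Π ]  :
-- prefix of ordinary components, last ordinary component, optional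
-- final m-component.
record Str : Set where
  constructor str
  field
    pre  : List Comp
    last : Comp
    mc   : Maybe Comp

data OCtx : Set where
  inPre  : List Comp → List Comp → Comp → Maybe Comp → OCtx
  atLast : List Comp → Maybe Comp → OCtx

plug : OCtx → Comp → Str
plug (inPre G₁ G₂ l m) c = str (G₁ ++ c ∷ G₂) l m
plug (atLast G m)      c = str G c m

data SCtx : Set where
  ord : OCtx → SCtx
  inM : List Comp → Comp → SCtx

plugS : SCtx → Comp → Str
plugS (ord S)   c = plug S c
plugS (inM G l) c = str G l (just c)

data _⊢_ (L : Logic) : Str → Set where
  init : ∀ S p Γ Δ → L ⊢ plug S (var p ∷ Γ ⇒ var p ∷ Δ)
  ⊥L   : ∀ S Γ Δ → L ⊢ plug S (⊥ᶠ ∷ Γ ⇒ Δ)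
  ⊤R   : ∀ S Γ Δ → L ⊢ plug S (Γ ⇒ ⊤ᶠ ∷ Δ)
  ¬L : ∀ S {Γ Δ A} → L ⊢ plug S (Γ ⇒ A ∷ Δ) → L ⊢ plug S (¬ᶠ A ∷ Γ ⇒ Δ)
  ¬R : ∀ S {Γ Δ A} → L ⊢ plug S (A ∷ Γ ⇒ Δ) → L ⊢ plug S (Γ ⇒ ¬ᶠ A ∷ Δ)
  ∧L : ∀ S {Γ Δ A B} → L ⊢ plug S (A ∷ B ∷ Γ ⇒ Δ) → L ⊢ plug S (A ∧ᶠ B ∷ Γ ⇒ Δ)
  ∧R : ∀ S {Γ Δ A B} → L ⊢ plug S (Γ ⇒ A ∷ Δ) → L ⊢ plug S (Γ ⇒ B ∷ Δ)
       → L ⊢ plug S (Γ ⇒ A ∧ᶠ B ∷ Δ)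
  ∨L : ∀ S {Γ Δ A B} → L ⊢ plug S (A ∷ Γ ⇒ Δ) → L ⊢ plug S (B ∷ Γ ⇒ Δ)
       → L ⊢ plug S (A ∨ᶠ B ∷ Γ ⇒ Δ)
  ∨R : ∀ S {Γ Δ A B} → L ⊢ plug S (Γ ⇒ A ∷ B ∷ Δ) → L ⊢ plug S (Γ ⇒ A ∨ᶠ B ∷ Δ)
  →L : ∀ S {Γ Δ A B} → L ⊢ plug S (Γ ⇒ A ∷ Δ) → L ⊢ plug S (B ∷ Γ ⇒ Δ)
       → L ⊢ plug S (A →ᶠ B ∷ Γ ⇒ Δ)
  →R : ∀ S {Γ Δ A B} → L ⊢ plug S (A ∷ Γ ⇒ B ∷ Δ) → L ⊢ plug S (Γ ⇒ A →ᶠ B ∷ Δ)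
  exch : ∀ S {Γ Δ Γ′ Δ′} → Γ ↭ Γ′ → Δ ↭ Δ′
         → L ⊢ plugS S (Γ ⇒ Δ) → L ⊢ plugS S (Γ′ ⇒ Δ′)
  wkL  : ∀ S {Γ Δ A} → L ⊢ plugS S (Γ ⇒ Δ) → L ⊢ plugS S (A ∷ Γ ⇒ Δ)
  wkR  : ∀ S {Γ Δ A} → L ⊢ plugS S (Γ ⇒ Δ) → L ⊢ plugS S (Γ ⇒ A ∷ Δ)
  ctrL : ∀ S {Γ Δ A} → L ⊢ plugS S (A ∷ A ∷ Γ ⇒ Δ) → L ⊢ plugS S (A ∷ Γ ⇒ Δ)
  ctrR : ∀ S {Γ Δ A} → L ⊢ plugS S (Γ ⇒ A ∷ A ∷ Δ) → L ⊢ plugS S (Γ ⇒ A ∷ Δ)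
  □R : ∀ G {Γ Δ B} → L ⊢ str G (Γ ⇒ Δ) (just ([] ⇒ B ∷ []))
       → L ⊢ str G (Γ ⇒ □ B ∷ Δ) nothing
  □L : ∀ G {Γ Δ Σ Π A} → L ⊢ str (G ++ [ Γ ⇒ Δ ]) (A ∷ Σ ⇒ Π) nothing
       → L ⊢ str G (□ A ∷ Γ ⇒ Δ) (just (Σ ⇒ Π))
  ruleC : C ∈ axioms L → ∀ G {c₀ c} → L ⊢ str G c₀ (just c)
          → L ⊢ str (G ++ [ c₀ ]) c nothing
  ruleN : N ∈ axioms L → ∀ G {c₀ c} → L ⊢ str (G ++ [ c₀ ]) c nothing
          → L ⊢ str G c₀ (just c)
  ruleP : P ∈ axioms L → ∀ G {Γ Δ} → L ⊢ str G (Γ ⇒ Δ) (just ([] ⇒ []))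
          → L ⊢ str G (Γ ⇒ Δ) nothing
  ruleD : D ∈ axioms L → ∀ G {Γ Δ A} → L ⊢ str G (Γ ⇒ Δ) (just (A ∷ [] ⇒ []))
          → L ⊢ str G (□ A ∷ Γ ⇒ Δ) nothing
  rule4 : ax4 ∈ axioms L → ∀ G {Γ Δ Σ Π A}
          → L ⊢ str (G ++ [ Γ ⇒ Δ ]) (□ A ∷ Σ ⇒ Π) nothing
          → L ⊢ str G (□ A ∷ Γ ⇒ Δ) (just (Σ ⇒ Π))
  rule5 : ax5 ∈ axioms L → ∀ G {Γ Δ Σ Π A}
          → L ⊢ str (G ++ [ Γ ⇒ Δ ]) (Σ ⇒ □ A ∷ Π) nothing
          → L ⊢ str G (Γ ⇒ □ A ∷ Δ) (just (Σ ⇒ Π))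

⇒_ : Fm → Str
⇒ A = str [] ([] ⇒ A ∷ []) nothing

-- Soundness reads a structure G₁ / … / Gₙ [/ₘ M] as a formula.  For the normal
-- logics it is the nested disjunction ⟦G₁⟧ ∨ □(⟦G₂⟧ ∨ □(… ∨ □ ⟦M⟧)), and every rule
-- preserves theoremhood of it, using N and C to reason under the boxes.  The monotone
-- logics cannot reason under boxes, but there the disjunction can be taken at the
-- meta level: some Gᵢ is a theorem, or ⟦Gₙ⟧ ∨ □ ⟦M⟧ is.
--
-- Completeness goes through a cut-free sequent calculus whose modal rules are jumps
-- read off the linear nested rules: a monotone jump is an opener (□R, P or D)
-- followed by a closer (□L, 4 or 5), a normal jump is the K45-style rule from
-- unbox Γ, boxes Γ ⇒ boxes Δ, B to Γ ⇒ □ B, Δ (and its D-variant).  Every axiom of ℒ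
-- is derivable there, tautologies by exhaustive decomposition, and modus ponens by
-- cut admissibility, proved by induction on the cut formula and the heights of the
-- two derivations.  Each jump is then replayed in LNS by the rules it came from; a
-- normal jump hands its boxed context over to the previous component with C.

module Submission where

open import Defs
open import Data.Bool using (Bool; true; false; not; _∧_; _∨_)
open import Data.Bool.Properties
  using (∧-assoc; ∧-comm; ∧-conicalˡ; ∧-conicalʳ; ∨-assoc; ∨-comm; ∨-inverseˡ; ¬-not; ∨-zeroʳ; ∧-zeroʳ)
  renaming (_≟_ to _≟ᵇ_)
open import Data.Empty using (⊥-elim)
open import Data.List using (List; []; _∷_; _++_; [_]; length; foldr; map)
open import Data.List.Properties using (++-identityʳ; map-id)
open import Data.List.Membership.Propositional using (_∈_; _∉_; lose; find)
open import Data.List.Membership.Propositional.Properties using (∈-++⁺ˡ; ∈-++⁺ʳ; ∈-++⁻; ∈-map⁺; ∈-map⁻; ∈-∃++)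
open import Data.List.Relation.Binary.Permutation.Propositional using (_↭_; ↭-swap; ↭-refl; ↭-sym; ↭-prep)
import Data.List.Relation.Binary.Permutation.Propositional as ↭
import Data.List.Membership.DecPropositional as DecMembership
open import Data.List.Relation.Binary.Permutation.Propositional.Properties using (shift; shifts)
open import Data.List.Relation.Binary.Subset.Propositional using (_⊆_)
open import Data.List.Relation.Binary.Subset.Propositional.Properties
  using (⊆-refl; ⊆-trans; ⊆-reflexive; ⊆-reflexive-↭; ++⁺ʳ; ++⁺ˡ; ∷⁺ʳ; ∈-∷⁺ʳ; xs⊆xs++ys; xs⊆x∷xs;
         Any-resp-⊆; All-resp-⊇)
import Data.List.Relation.Binary.Subset.Propositional.Properties as ⊆
open import Data.List.Relation.Unary.All using (All; []; _∷_; lookup; tabulate)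
import Data.List.Relation.Unary.All.Properties as All
open import Data.List.Relation.Unary.Any using (Any; here; there; any?)
import Data.List.Relation.Unary.Any.Properties as Any
open import Data.Maybe using (Maybe; just; nothing)
open import Data.Nat using (ℕ; zero; suc; _+_; _≤_; _<_; z≤n; s≤s; _⊔_)
import Data.Nat as ℕ
open import Data.Nat.Properties
  using (≤∧≢⇒<; m≤m⊔n; m≤n⊔m; +-assoc; +-identityʳ; ≤-refl; ≤-reflexive; ≤-trans; ≤-pred; m≤m+n; m≤n+m; +-monoˡ-<;
         +-commutativeSemigroup; module ≤-Reasoning)
open import Algebra.Properties.CommutativeSemigroup +-commutativeSemigroup using (interchange)
open import Data.Product using (Σ; ∃; _×_; _,_; proj₁; proj₂)
open import Data.Sum using (_⊎_; inj₁; inj₂; [_,_]′)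
open import Data.Unit using (⊤; tt)
open import Function using (_∘_; id)
open import Relation.Binary.Definitions using (DecidableEquality)
open import Relation.Binary.PropositionalEquality using (_≡_; _≢_; refl; cong; cong₂; subst; sym; trans)
open import Relation.Nullary using (Dec; yes; no; does; ¬_)
open import Relation.Nullary.Decidable using (map′; _×-dec_; dec-true)

isNormal : Logic → Bool
isNormal K45  = true
isNormal KD45 = true
isNormal _    = false

ax5∈ : ∀ L → ax5 ∈ axioms L
ax5∈ M5   = here refl
ax5∈ MP5  = there (here refl)
ax5∈ M45  = there (here refl)
ax5∈ MP45 = there (there (here refl))
ax5∈ MD45 = there (there (here refl))
ax5∈ K45  = there (there (there (here refl)))
ax5∈ KD45 = there (there (there (there (here refl))))

D∈⇒ax4∈ : ∀ {L} → D ∈ axioms L → ax4 ∈ axioms L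
D∈⇒ax4∈ {M5}   (there ())
D∈⇒ax4∈ {MP5}  (there (there ()))
D∈⇒ax4∈ {M45}  (there (there ()))
D∈⇒ax4∈ {MP45} (there (there (there ())))
D∈⇒ax4∈ {MD45} _ = there (here refl)
D∈⇒ax4∈ {K45}  (there (there (there (there ()))))
D∈⇒ax4∈ {KD45} _ = there (there (there (here refl)))

normal⇒N∈ : ∀ {L} → isNormal L ≡ true → N ∈ axioms L
normal⇒N∈ {K45}  _ = here refl
normal⇒N∈ {KD45} _ = here refl

normal⇒C∈ : ∀ {L} → isNormal L ≡ true → C ∈ axioms L
normal⇒C∈ {K45}  _ = there (here refl)
normal⇒C∈ {KD45} _ = there (here refl)

normal⇒ax4∈ : ∀ {L} → isNormal L ≡ true → ax4 ∈ axioms L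
normal⇒ax4∈ {K45}  _ = there (there (here refl))
normal⇒ax4∈ {KD45} _ = there (there (there (here refl)))

normal⇒P∉ : ∀ {L} → isNormal L ≡ true → P ∉ axioms L
normal⇒P∉ {K45}  _ (there (there (there (there ()))))
normal⇒P∉ {KD45} _ (there (there (there (there (there ())))))

monotone⇒C∉ : ∀ {L} → isNormal L ≡ false → C ∉ axioms L
monotone⇒C∉ {M5}   _ (there ())
monotone⇒C∉ {MP5}  _ (there (there ()))
monotone⇒C∉ {M45}  _ (there (there ()))
monotone⇒C∉ {MP45} _ (there (there (there ())))
monotone⇒C∉ {MD45} _ (there (there (there ())))

monotone⇒N∉ : ∀ {L} → isNormal L ≡ false → N ∉ axioms L
monotone⇒N∉ {M5}   _ (there ())
monotone⇒N∉ {MP5}  _ (there (there ()))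
monotone⇒N∉ {M45}  _ (there (there ()))
monotone⇒N∉ {MP45} _ (there (there (there ())))
monotone⇒N∉ {MD45} _ (there (there (there ())))

⋀ ⋁ : List Fm → Fm
⋀ = foldr _∧ᶠ_ ⊤ᶠ
⋁ = foldr _∨ᶠ_ ⊥ᶠ

⟦_⟧ : Comp → Fm
⟦ Γ ⇒ Δ ⟧ = ⋀ Γ →ᶠ ⋁ Δ

-- A propositional schema is a box-free formula whose variable i stands for the
-- i-th formula of a list (⊥ᶠ past its end).  Truth tables of the schema decide
-- whether all of its instances are tautologies.

lookup⊥ : List Fm → ℕ → Fm
lookup⊥ []       _       = ⊥ᶠ
lookup⊥ (A ∷ _)  zero    = A
lookup⊥ (_ ∷ As) (suc i) = lookup⊥ As i

instantiate : List Fm → Fm → Fm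
instantiate As (var i)  = lookup⊥ As i
instantiate As ⊥ᶠ       = ⊥ᶠ
instantiate As ⊤ᶠ       = ⊤ᶠ
instantiate As (¬ᶠ φ)   = ¬ᶠ instantiate As φ
instantiate As (φ ∧ᶠ ψ) = instantiate As φ ∧ᶠ instantiate As ψ
instantiate As (φ ∨ᶠ ψ) = instantiate As φ ∨ᶠ instantiate As ψ
instantiate As (φ →ᶠ ψ) = instantiate As φ →ᶠ instantiate As ψ
instantiate As (□ φ)    = □ instantiate As φ

isBoxFree : Fm → Bool
isBoxFree (¬ᶠ φ)   = isBoxFree φ
isBoxFree (φ ∧ᶠ ψ) = isBoxFree φ ∧ isBoxFree ψ
isBoxFree (φ ∨ᶠ ψ) = isBoxFree φ ∧ isBoxFree ψ
isBoxFree (φ →ᶠ ψ) = isBoxFree φ ∧ isBoxFree ψ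
isBoxFree (□ φ)    = false
isBoxFree _        = true

evalᵖ : (ℕ → Bool) → Fm → Bool
evalᵖ ρ (var i)  = ρ i
evalᵖ ρ ⊥ᶠ       = false
evalᵖ ρ ⊤ᶠ       = true
evalᵖ ρ (¬ᶠ φ)   = not (evalᵖ ρ φ)
evalᵖ ρ (φ ∧ᶠ ψ) = evalᵖ ρ φ ∧ evalᵖ ρ ψ
evalᵖ ρ (φ ∨ᶠ ψ) = evalᵖ ρ φ ∨ evalᵖ ρ ψ
evalᵖ ρ (φ →ᶠ ψ) = not (evalᵖ ρ φ) ∨ evalᵖ ρ ψ
evalᵖ ρ (□ φ)    = false

_[_≔_] : (ℕ → Bool) → ℕ → Bool → ℕ → Bool
(ρ [ n ≔ b ]) i with i ℕ.≟ n
... | yes _ = b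
... | no  _ = ρ i

-- true iff φ holds under every valuation that agrees with ρ on the variables ≥ n
holdsBelow : ℕ → (ℕ → Bool) → Fm → Bool
holdsBelow zero    ρ φ = evalᵖ ρ φ
holdsBelow (suc n) ρ φ = holdsBelow n (ρ [ n ≔ true ]) φ ∧ holdsBelow n (ρ [ n ≔ false ]) φ

isTautologySchema : ℕ → Fm → Bool
isTautologySchema n φ = isBoxFree φ ∧ holdsBelow n (λ _ → false) φ

evalᵖ-cong : ∀ {ρ σ} φ → (∀ i → ρ i ≡ σ i) → evalᵖ ρ φ ≡ evalᵖ σ φ
evalᵖ-cong (var i)  e = e i
evalᵖ-cong ⊥ᶠ       e = refl
evalᵖ-cong ⊤ᶠ       e = refl
evalᵖ-cong (¬ᶠ φ)   e = cong not (evalᵖ-cong φ e)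
evalᵖ-cong (φ ∧ᶠ ψ) e = cong₂ _∧_ (evalᵖ-cong φ e) (evalᵖ-cong ψ e)
evalᵖ-cong (φ ∨ᶠ ψ) e = cong₂ _∨_ (evalᵖ-cong φ e) (evalᵖ-cong ψ e)
evalᵖ-cong (φ →ᶠ ψ) e = cong₂ (λ a b → not a ∨ b) (evalᵖ-cong φ e) (evalᵖ-cong ψ e)
evalᵖ-cong (□ φ)    e = refl

holdsBelow-sound : ∀ n ρ φ → holdsBelow n ρ φ ≡ true
                   → ∀ σ → (∀ i → n ≤ i → σ i ≡ ρ i) → evalᵖ σ φ ≡ true
holdsBelow-sound zero    ρ φ h σ agree = trans (evalᵖ-cong φ (λ i → agree i z≤n)) h
holdsBelow-sound (suc n) ρ φ h σ agree = holdsBelow-sound n (ρ [ n ≔ σ n ]) φ (row (σ n) h) σ agree′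
  where
  row : ∀ b → holdsBelow n (ρ [ n ≔ true ]) φ ∧ holdsBelow n (ρ [ n ≔ false ]) φ ≡ true
        → holdsBelow n (ρ [ n ≔ b ]) φ ≡ true
  row true  h = ∧-conicalˡ _ _ h
  row false h = ∧-conicalʳ _ _ h
  agree′ : ∀ i → n ≤ i → σ i ≡ (ρ [ n ≔ σ n ]) i
  agree′ i n≤i with i ℕ.≟ n
  ... | yes refl = refl
  ... | no  i≢n  = agree i (≤∧≢⇒< n≤i (i≢n ∘ sym))

eval-instantiate : ∀ v As φ → isBoxFree φ ≡ true
                   → eval v (instantiate As φ) ≡ evalᵖ (λ i → eval v (lookup⊥ As i)) φ
eval-instantiate v As (var i)  _ = refl
eval-instantiate v As ⊥ᶠ       _ = refl
eval-instantiate v As ⊤ᶠ       _ = refl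
eval-instantiate v As (¬ᶠ φ)   b = cong not (eval-instantiate v As φ b)
eval-instantiate v As (φ ∧ᶠ ψ) b =
  cong₂ _∧_ (eval-instantiate v As φ (∧-conicalˡ _ _ b)) (eval-instantiate v As ψ (∧-conicalʳ _ _ b))
eval-instantiate v As (φ ∨ᶠ ψ) b =
  cong₂ _∨_ (eval-instantiate v As φ (∧-conicalˡ _ _ b)) (eval-instantiate v As ψ (∧-conicalʳ _ _ b))
eval-instantiate v As (φ →ᶠ ψ) b =
  cong₂ (λ a c → not a ∨ c) (eval-instantiate v As φ (∧-conicalˡ _ _ b)) (eval-instantiate v As ψ (∧-conicalʳ _ _ b))

lookup⊥-beyond : ∀ v As i → length As ≤ i → eval v (lookup⊥ As i) ≡ false
lookup⊥-beyond v []       i       _         = refl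
lookup⊥-beyond v (_ ∷ As) (suc i) (s≤s le) = lookup⊥-beyond v As i le

instantiate-tautology : ∀ φ As → isTautologySchema (length As) φ ≡ true
                        → Tautology (instantiate As φ)
instantiate-tautology φ As h v =
  trans (eval-instantiate v As φ (∧-conicalˡ _ _ h))
        (holdsBelow-sound (length As) (λ _ → false) φ (∧-conicalʳ _ _ h) (λ i → eval v (lookup⊥ As i))
                          (lookup⊥-beyond v As))

x₀ x₁ x₂ x₃ x₄ x₅ x₆ : Fm
x₀ = var 0
x₁ = var 1
x₂ = var 2
x₃ = var 3
x₄ = var 4
x₅ = var 5
x₆ = var 6

module HilbertReasoning (L : Logic) where

  byTaut : ∀ φ As → isTautologySchema (length As) φ ≡ true → L ⊢H instantiate As φ
  byTaut φ As h = taut (instantiate-tautology φ As h)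

  □-mono : ∀ {A B} → L ⊢H (A →ᶠ B) → L ⊢H (□ A →ᶠ □ B)
  □-mono {A} {B} A→B =
    mp (mp (byTaut ((x₀ →ᶠ x₁) →ᶠ (x₁ →ᶠ x₀ ∧ᶠ x₂) →ᶠ x₀ →ᶠ x₂) (□ A ∷ □ (A ∧ᶠ B) ∷ □ B ∷ []) refl)
           (re A→A∧B (byTaut (x₀ ∧ᶠ x₁ →ᶠ x₀) (A ∷ B ∷ []) refl)))
       (axM A B)
    where
    A→A∧B : L ⊢H (A →ᶠ A ∧ᶠ B)
    A→A∧B = mp (byTaut ((x₀ →ᶠ x₁) →ᶠ x₀ →ᶠ x₀ ∧ᶠ x₁) (A ∷ B ∷ []) refl) A→B

eval-⋀-↭ : ∀ v {Γ Γ′} → Γ ↭ Γ′ → eval v (⋀ Γ) ≡ eval v (⋀ Γ′)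
eval-⋀-↭ v ↭.refl           = refl
eval-⋀-↭ v (↭.prep A p)     = cong (eval v A ∧_) (eval-⋀-↭ v p)
eval-⋀-↭ v (↭.swap {xs = Γ} A B p) = trans (left-comm (eval v A) (eval v B) (eval v (⋀ Γ)))
                                         (cong (λ b → eval v B ∧ (eval v A ∧ b)) (eval-⋀-↭ v p))
  where
  left-comm : ∀ a b c → a ∧ (b ∧ c) ≡ b ∧ (a ∧ c)
  left-comm a b c = trans (sym (∧-assoc a b c)) (trans (cong (_∧ c) (∧-comm a b)) (∧-assoc b a c))
eval-⋀-↭ v (↭.trans p q)    = trans (eval-⋀-↭ v p) (eval-⋀-↭ v q)

eval-⋁-↭ : ∀ v {Δ Δ′} → Δ ↭ Δ′ → eval v (⋁ Δ) ≡ eval v (⋁ Δ′)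
eval-⋁-↭ v ↭.refl           = refl
eval-⋁-↭ v (↭.prep A p)     = cong (eval v A ∨_) (eval-⋁-↭ v p)
eval-⋁-↭ v (↭.swap {xs = Δ} A B p) = trans (left-comm (eval v A) (eval v B) (eval v (⋁ Δ)))
                                         (cong (λ b → eval v B ∨ (eval v A ∨ b)) (eval-⋁-↭ v p))
  where
  left-comm : ∀ a b c → a ∨ (b ∨ c) ≡ b ∨ (a ∨ c)
  left-comm a b c = trans (sym (∨-assoc a b c)) (trans (cong (_∨ c) (∨-comm a b)) (∨-assoc b a c))
eval-⋁-↭ v (↭.trans p q)    = trans (eval-⋁-↭ v p) (eval-⋁-↭ v q)

module ComponentRules (L : Logic) where
  open HilbertReasoning L

  -- The side formula X stands for the interpretation of the rest of the structure,
  -- so a propositional rule is sound inside any structure.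
  Sound₀ : Comp → Set
  Sound₀ c = ∀ X → L ⊢H (⟦ c ⟧ ∨ᶠ X)

  Sound₁ : Comp → Comp → Set
  Sound₁ c₁ c = ∀ X → L ⊢H ((⟦ c₁ ⟧ ∨ᶠ X) →ᶠ ⟦ c ⟧ ∨ᶠ X)

  Sound₂ : Comp → Comp → Comp → Set
  Sound₂ c₁ c₂ c = ∀ X → L ⊢H ((⟦ c₁ ⟧ ∨ᶠ X) →ᶠ (⟦ c₂ ⟧ ∨ᶠ X) →ᶠ ⟦ c ⟧ ∨ᶠ X)

  private
    slots : Fm → Fm → List Fm → List Fm → Fm → List Fm
    slots A B Γ Δ X = A ∷ B ∷ ⋀ Γ ∷ ⋁ Δ ∷ X ∷ []

  init-sound : ∀ p Γ Δ → Sound₀ (var p ∷ Γ ⇒ var p ∷ Δ)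
  init-sound p Γ Δ X = byTaut ((x₀ ∧ᶠ x₂ →ᶠ x₀ ∨ᶠ x₃) ∨ᶠ x₄) (slots (var p) ⊥ᶠ Γ Δ X) refl

  ⊥L-sound : ∀ Γ Δ → Sound₀ (⊥ᶠ ∷ Γ ⇒ Δ)
  ⊥L-sound Γ Δ X = byTaut ((⊥ᶠ ∧ᶠ x₂ →ᶠ x₃) ∨ᶠ x₄) (slots ⊥ᶠ ⊥ᶠ Γ Δ X) refl

  ⊤R-sound : ∀ Γ Δ → Sound₀ (Γ ⇒ ⊤ᶠ ∷ Δ)
  ⊤R-sound Γ Δ X = byTaut ((x₂ →ᶠ ⊤ᶠ ∨ᶠ x₃) ∨ᶠ x₄) (slots ⊥ᶠ ⊥ᶠ Γ Δ X) refl

  ¬L-sound : ∀ Γ Δ A → Sound₁ (Γ ⇒ A ∷ Δ) (¬ᶠ A ∷ Γ ⇒ Δ)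
  ¬L-sound Γ Δ A X =
    byTaut ((x₂ →ᶠ x₀ ∨ᶠ x₃) ∨ᶠ x₄ →ᶠ (¬ᶠ x₀ ∧ᶠ x₂ →ᶠ x₃) ∨ᶠ x₄) (slots A ⊥ᶠ Γ Δ X) refl

  ¬R-sound : ∀ Γ Δ A → Sound₁ (A ∷ Γ ⇒ Δ) (Γ ⇒ ¬ᶠ A ∷ Δ)
  ¬R-sound Γ Δ A X =
    byTaut ((x₀ ∧ᶠ x₂ →ᶠ x₃) ∨ᶠ x₄ →ᶠ (x₂ →ᶠ ¬ᶠ x₀ ∨ᶠ x₃) ∨ᶠ x₄) (slots A ⊥ᶠ Γ Δ X) refl

  ∧L-sound : ∀ Γ Δ A B → Sound₁ (A ∷ B ∷ Γ ⇒ Δ) (A ∧ᶠ B ∷ Γ ⇒ Δ)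
  ∧L-sound Γ Δ A B X =
    byTaut ((x₀ ∧ᶠ x₁ ∧ᶠ x₂ →ᶠ x₃) ∨ᶠ x₄ →ᶠ ((x₀ ∧ᶠ x₁) ∧ᶠ x₂ →ᶠ x₃) ∨ᶠ x₄) (slots A B Γ Δ X) refl

  ∧R-sound : ∀ Γ Δ A B → Sound₂ (Γ ⇒ A ∷ Δ) (Γ ⇒ B ∷ Δ) (Γ ⇒ A ∧ᶠ B ∷ Δ)
  ∧R-sound Γ Δ A B X =
    byTaut ((x₂ →ᶠ x₀ ∨ᶠ x₃) ∨ᶠ x₄ →ᶠ (x₂ →ᶠ x₁ ∨ᶠ x₃) ∨ᶠ x₄ →ᶠ (x₂ →ᶠ x₀ ∧ᶠ x₁ ∨ᶠ x₃) ∨ᶠ x₄)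
           (slots A B Γ Δ X) refl

  ∨L-sound : ∀ Γ Δ A B → Sound₂ (A ∷ Γ ⇒ Δ) (B ∷ Γ ⇒ Δ) (A ∨ᶠ B ∷ Γ ⇒ Δ)
  ∨L-sound Γ Δ A B X =
    byTaut ((x₀ ∧ᶠ x₂ →ᶠ x₃) ∨ᶠ x₄ →ᶠ (x₁ ∧ᶠ x₂ →ᶠ x₃) ∨ᶠ x₄ →ᶠ ((x₀ ∨ᶠ x₁) ∧ᶠ x₂ →ᶠ x₃) ∨ᶠ x₄)
           (slots A B Γ Δ X) refl

  ∨R-sound : ∀ Γ Δ A B → Sound₁ (Γ ⇒ A ∷ B ∷ Δ) (Γ ⇒ A ∨ᶠ B ∷ Δ)
  ∨R-sound Γ Δ A B X =
    byTaut ((x₂ →ᶠ x₀ ∨ᶠ x₁ ∨ᶠ x₃) ∨ᶠ x₄ →ᶠ (x₂ →ᶠ (x₀ ∨ᶠ x₁) ∨ᶠ x₃) ∨ᶠ x₄) (slots A B Γ Δ X) refl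

  →L-sound : ∀ Γ Δ A B → Sound₂ (Γ ⇒ A ∷ Δ) (B ∷ Γ ⇒ Δ) (A →ᶠ B ∷ Γ ⇒ Δ)
  →L-sound Γ Δ A B X =
    byTaut ((x₂ →ᶠ x₀ ∨ᶠ x₃) ∨ᶠ x₄ →ᶠ (x₁ ∧ᶠ x₂ →ᶠ x₃) ∨ᶠ x₄ →ᶠ ((x₀ →ᶠ x₁) ∧ᶠ x₂ →ᶠ x₃) ∨ᶠ x₄)
           (slots A B Γ Δ X) refl

  →R-sound : ∀ Γ Δ A B → Sound₁ (A ∷ Γ ⇒ B ∷ Δ) (Γ ⇒ A →ᶠ B ∷ Δ)
  →R-sound Γ Δ A B X =
    byTaut ((x₀ ∧ᶠ x₂ →ᶠ x₁ ∨ᶠ x₃) ∨ᶠ x₄ →ᶠ (x₂ →ᶠ (x₀ →ᶠ x₁) ∨ᶠ x₃) ∨ᶠ x₄) (slots A B Γ Δ X) refl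

  wkL-sound : ∀ Γ Δ A → Sound₁ (Γ ⇒ Δ) (A ∷ Γ ⇒ Δ)
  wkL-sound Γ Δ A X = byTaut ((x₂ →ᶠ x₃) ∨ᶠ x₄ →ᶠ (x₀ ∧ᶠ x₂ →ᶠ x₃) ∨ᶠ x₄) (slots A ⊥ᶠ Γ Δ X) refl

  wkR-sound : ∀ Γ Δ A → Sound₁ (Γ ⇒ Δ) (Γ ⇒ A ∷ Δ)
  wkR-sound Γ Δ A X = byTaut ((x₂ →ᶠ x₃) ∨ᶠ x₄ →ᶠ (x₂ →ᶠ x₀ ∨ᶠ x₃) ∨ᶠ x₄) (slots A ⊥ᶠ Γ Δ X) refl

  ctrL-sound : ∀ Γ Δ A → Sound₁ (A ∷ A ∷ Γ ⇒ Δ) (A ∷ Γ ⇒ Δ)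
  ctrL-sound Γ Δ A X =
    byTaut ((x₀ ∧ᶠ x₀ ∧ᶠ x₂ →ᶠ x₃) ∨ᶠ x₄ →ᶠ (x₀ ∧ᶠ x₂ →ᶠ x₃) ∨ᶠ x₄) (slots A ⊥ᶠ Γ Δ X) refl

  ctrR-sound : ∀ Γ Δ A → Sound₁ (Γ ⇒ A ∷ A ∷ Δ) (Γ ⇒ A ∷ Δ)
  ctrR-sound Γ Δ A X =
    byTaut ((x₂ →ᶠ x₀ ∨ᶠ x₀ ∨ᶠ x₃) ∨ᶠ x₄ →ᶠ (x₂ →ᶠ x₀ ∨ᶠ x₃) ∨ᶠ x₄) (slots A ⊥ᶠ Γ Δ X) refl

  exch-sound : ∀ {Γ Δ Γ′ Δ′} → Γ ↭ Γ′ → Δ ↭ Δ′ → Sound₁ (Γ ⇒ Δ) (Γ′ ⇒ Δ′)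
  exch-sound {Γ} {Δ} {Γ′} {Δ′} Γ↭Γ′ Δ↭Δ′ X = taut λ v →
    subst (λ b → not (b ∨ eval v X) ∨ eval v (⟦ Γ′ ⇒ Δ′ ⟧ ∨ᶠ X) ≡ true)
          (sym (cong₂ (λ a b → not a ∨ b) (eval-⋀-↭ v Γ↭Γ′) (eval-⋁-↭ v Δ↭Δ′)))
          (∨-inverseˡ (eval v (⟦ Γ′ ⇒ Δ′ ⟧ ∨ᶠ X)))

  ⇒-sound : ∀ {A} → L ⊢H (⟦ [] ⇒ A ∷ [] ⟧ ∨ᶠ ⊥ᶠ) → L ⊢H A
  ⇒-sound {A} = mp (byTaut ((⊤ᶠ →ᶠ x₀ ∨ᶠ ⊥ᶠ) ∨ᶠ ⊥ᶠ →ᶠ x₀) (A ∷ []) refl)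

  Sound₁-implication : ∀ {c₁ c} → Sound₁ c₁ c → L ⊢H (⟦ c₁ ⟧ →ᶠ ⟦ c ⟧)
  Sound₁-implication {c₁} {c} r =
    mp (byTaut ((x₀ ∨ᶠ ⊥ᶠ →ᶠ x₁ ∨ᶠ ⊥ᶠ) →ᶠ x₀ →ᶠ x₁) (⟦ c₁ ⟧ ∷ ⟦ c ⟧ ∷ []) refl) (r ⊥ᶠ)

⟦_⟧ᵐ : Maybe Comp → Fm
⟦ nothing ⟧ᵐ = ⊥ᶠ
⟦ just c  ⟧ᵐ = □ ⟦ c ⟧

module OpeningRules (L : Logic) where
  open HilbertReasoning L

  □R-opens : ∀ Γ Δ B → L ⊢H ((⟦ Γ ⇒ Δ ⟧ ∨ᶠ □ ⟦ [] ⇒ B ∷ [] ⟧) →ᶠ ⟦ Γ ⇒ □ B ∷ Δ ⟧ ∨ᶠ ⊥ᶠ)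
  □R-opens Γ Δ B =
    mp (byTaut ((x₂ →ᶠ x₃) →ᶠ (x₀ →ᶠ x₁) ∨ᶠ x₂ →ᶠ (x₀ →ᶠ x₃ ∨ᶠ x₁) ∨ᶠ ⊥ᶠ)
               (⋀ Γ ∷ ⋁ Δ ∷ □ ⟦ [] ⇒ B ∷ [] ⟧ ∷ □ B ∷ []) refl)
       (□-mono (byTaut ((⊤ᶠ →ᶠ x₀ ∨ᶠ ⊥ᶠ) →ᶠ x₀) (B ∷ []) refl))

  P-opens : P ∈ axioms L → ∀ Γ Δ → L ⊢H ((⟦ Γ ⇒ Δ ⟧ ∨ᶠ □ ⟦ [] ⇒ [] ⟧) →ᶠ ⟦ Γ ⇒ Δ ⟧ ∨ᶠ ⊥ᶠ)
  P-opens P∈ Γ Δ =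
    mp (mp (byTaut ((x₂ →ᶠ x₃) →ᶠ ¬ᶠ x₃ →ᶠ (x₀ →ᶠ x₁) ∨ᶠ x₂ →ᶠ (x₀ →ᶠ x₁) ∨ᶠ ⊥ᶠ)
                   (⋀ Γ ∷ ⋁ Δ ∷ □ ⟦ [] ⇒ [] ⟧ ∷ □ ⊥ᶠ ∷ []) refl)
           (□-mono (byTaut ((⊤ᶠ →ᶠ ⊥ᶠ) →ᶠ ⊥ᶠ) [] refl)))
       (ax P∈ instP)

  D-opens : D ∈ axioms L → ∀ Γ Δ A
            → L ⊢H ((⟦ Γ ⇒ Δ ⟧ ∨ᶠ □ ⟦ A ∷ [] ⇒ [] ⟧) →ᶠ ⟦ □ A ∷ Γ ⇒ Δ ⟧ ∨ᶠ ⊥ᶠ)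
  D-opens D∈ Γ Δ A =
    mp (mp (byTaut ((x₂ →ᶠ x₃) →ᶠ ¬ᶠ (x₄ ∧ᶠ x₃) →ᶠ (x₀ →ᶠ x₁) ∨ᶠ x₂ →ᶠ (x₄ ∧ᶠ x₀ →ᶠ x₁) ∨ᶠ ⊥ᶠ)
                   (⋀ Γ ∷ ⋁ Δ ∷ □ ⟦ A ∷ [] ⇒ [] ⟧ ∷ □ (¬ᶠ A) ∷ □ A ∷ []) refl)
           (□-mono (byTaut ((x₀ ∧ᶠ ⊤ᶠ →ᶠ ⊥ᶠ) →ᶠ ¬ᶠ x₀) (A ∷ []) refl)))
       (ax D∈ (instD A))

module MonotoneSoundness (L : Logic) (monotone : isNormal L ≡ false) where
  open HilbertReasoning L
  open ComponentRules L
  open OpeningRules L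

  data Valid : Str → Set where
    earlier : ∀ {G c m} → Any (λ g → L ⊢H ⟦ g ⟧) G → Valid (str G c m)
    final   : ∀ {G c m} → L ⊢H (⟦ c ⟧ ∨ᶠ ⟦ m ⟧ᵐ) → Valid (str G c m)

  HoleValid : OCtx → Comp → Set
  HoleValid (inPre _ _ _ _) c = L ⊢H ⟦ c ⟧
  HoleValid (atLast _ m)    c = L ⊢H (⟦ c ⟧ ∨ᶠ ⟦ m ⟧ᵐ)

  fill : ∀ S {c} → HoleValid S c → Valid (plug S c)
  fill (inPre G₁ _ _ _) h = earlier (Any.++⁺ʳ G₁ (here h))
  fill (atLast _ _)     h = final h

  focus : ∀ S {c₁} c → Valid (plug S c₁) → HoleValid S c₁ ⊎ Valid (plug S c)
  focus (inPre G₁ _ _ _) c (earlier a) with Any.++⁻ G₁ a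
  ... | inj₁ a₁         = inj₂ (earlier (Any.++⁺ˡ a₁))
  ... | inj₂ (here h)   = inj₁ h
  ... | inj₂ (there a₂) = inj₂ (earlier (Any.++⁺ʳ G₁ (there a₂)))
  focus (inPre _ _ _ _) c (final h)   = inj₂ (final h)
  focus (atLast _ _)    c (earlier a) = inj₂ (earlier a)
  focus (atLast _ _)    c (final h)   = inj₁ h

  private
    strip⊥ : ∀ {Y} → L ⊢H (Y ∨ᶠ ⊥ᶠ) → L ⊢H Y
    strip⊥ {Y} = mp (byTaut (x₀ ∨ᶠ ⊥ᶠ →ᶠ x₀) (Y ∷ []) refl)

    add⊥ : ∀ {Y} → L ⊢H Y → L ⊢H (Y ∨ᶠ ⊥ᶠ)
    add⊥ {Y} = mp (byTaut (x₀ →ᶠ x₀ ∨ᶠ ⊥ᶠ) (Y ∷ []) refl)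

  hole-sound₁ : ∀ S {c₁ c} → Sound₁ c₁ c → HoleValid S c₁ → HoleValid S c
  hole-sound₁ (inPre _ _ _ _) r h = strip⊥ (mp (r ⊥ᶠ) (add⊥ h))
  hole-sound₁ (atLast _ m)    r h = mp (r ⟦ m ⟧ᵐ) h

  sound₀ : ∀ S {c} → Sound₀ c → Valid (plug S c)
  sound₀ S@(inPre _ _ _ _) {c} r = fill S {c} (strip⊥ (r ⊥ᶠ))
  sound₀ S@(atLast _ m)    {c} r = fill S {c} (r ⟦ m ⟧ᵐ)

  sound₁ : ∀ S {c₁ c} → Sound₁ c₁ c → Valid (plug S c₁) → Valid (plug S c)
  sound₁ S {c₁} {c} r v with focus S c v
  ... | inj₂ w = w
  ... | inj₁ h = fill S (hole-sound₁ S {c₁} {c} r h)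

  sound₂ : ∀ S {c₁ c₂ c} → Sound₂ c₁ c₂ c → Valid (plug S c₁) → Valid (plug S c₂) → Valid (plug S c)
  sound₂ S {c₁} {c₂} {c} r v w with focus S c v | focus S c w
  ... | inj₂ u  | _      = u
  ... | inj₁ _  | inj₂ u = u
  ... | inj₁ h₁ | inj₁ h₂ = fill S (hole₂ S h₁ h₂)
    where
    hole₂ : ∀ S → HoleValid S c₁ → HoleValid S c₂ → HoleValid S c
    hole₂ (inPre _ _ _ _) h₁ h₂ = strip⊥ (mp (mp (r ⊥ᶠ) (add⊥ h₁)) (add⊥ h₂))
    hole₂ (atLast _ m)    h₁ h₂ = mp (mp (r ⟦ m ⟧ᵐ) h₁) h₂

  soundS : ∀ S {c₁ c} → Sound₁ c₁ c → Valid (plugS S c₁) → Valid (plugS S c)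
  soundS (ord S)   r v        = sound₁ S r v
  soundS (inM _ _) r (earlier a) = earlier a
  soundS (inM _ l) {c₁} {c} r (final h) =
    final (mp (mp (byTaut (x₀ ∨ᶠ x₁ →ᶠ (x₁ →ᶠ x₂) →ᶠ x₀ ∨ᶠ x₂) (⟦ l ⟧ ∷ □ ⟦ c₁ ⟧ ∷ □ ⟦ c ⟧ ∷ []) refl) h)
             (□-mono (Sound₁-implication {c₁} {c} r)))

  opening-sound : ∀ G {c₀ c₀′ m} → L ⊢H ((⟦ c₀ ⟧ ∨ᶠ □ ⟦ m ⟧) →ᶠ ⟦ c₀′ ⟧ ∨ᶠ ⊥ᶠ)
                  → Valid (str G c₀ (just m)) → Valid (str G c₀′ nothing)
  opening-sound G _ (earlier a) = earlier a
  opening-sound G f (final h)   = final (mp f h)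

  closing-sound : ∀ G {c₀ c c₀′ m}
                  → L ⊢H (⟦ c₀ ⟧ →ᶠ ⟦ c₀′ ⟧ ∨ᶠ □ ⟦ m ⟧)
                  → (L ⊢H (⟦ c ⟧ ∨ᶠ ⊥ᶠ) → L ⊢H (⟦ c₀′ ⟧ ∨ᶠ □ ⟦ m ⟧))
                  → Valid (str (G ++ [ c₀ ]) c nothing) → Valid (str G c₀′ (just m))
  closing-sound G _ g (final h)   = final (g h)
  closing-sound G f g (earlier a) with Any.++⁻ G a
  ... | inj₁ a′       = earlier a′
  ... | inj₂ (here h) = final (mp f h)

  private
    weakenˡ : ∀ Γ Δ Σ Π F → L ⊢H (⟦ Γ ⇒ Δ ⟧ →ᶠ ⟦ F ∷ Γ ⇒ Δ ⟧ ∨ᶠ □ ⟦ Σ ⇒ Π ⟧)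
    weakenˡ Γ Δ Σ Π F =
      byTaut ((x₀ →ᶠ x₁) →ᶠ (x₂ ∧ᶠ x₀ →ᶠ x₁) ∨ᶠ x₃) (⋀ Γ ∷ ⋁ Δ ∷ F ∷ □ ⟦ Σ ⇒ Π ⟧ ∷ []) refl

    weakenʳ : ∀ Γ Δ Σ Π F → L ⊢H (⟦ Γ ⇒ Δ ⟧ →ᶠ ⟦ Γ ⇒ F ∷ Δ ⟧ ∨ᶠ □ ⟦ Σ ⇒ Π ⟧)
    weakenʳ Γ Δ Σ Π F =
      byTaut ((x₀ →ᶠ x₁) →ᶠ (x₀ →ᶠ x₂ ∨ᶠ x₁) ∨ᶠ x₃) (⋀ Γ ∷ ⋁ Δ ∷ F ∷ □ ⟦ Σ ⇒ Π ⟧ ∷ []) refl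

    □-antecedent : ∀ {F Σ Π} → L ⊢H (⟦ F ∷ Σ ⇒ Π ⟧ ∨ᶠ ⊥ᶠ) → L ⊢H (□ F →ᶠ □ ⟦ Σ ⇒ Π ⟧)
    □-antecedent {F} {Σ} {Π} h =
      □-mono (mp (byTaut ((x₀ ∧ᶠ x₁ →ᶠ x₂) ∨ᶠ ⊥ᶠ →ᶠ x₀ →ᶠ x₁ →ᶠ x₂) (F ∷ ⋀ Σ ∷ ⋁ Π ∷ []) refl) h)

  □L-sound : ∀ G {Γ Δ Σ Π A} → Valid (str (G ++ [ Γ ⇒ Δ ]) (A ∷ Σ ⇒ Π) nothing)
             → Valid (str G (□ A ∷ Γ ⇒ Δ) (just (Σ ⇒ Π)))
  □L-sound G {Γ} {Δ} {Σ} {Π} {A} = closing-sound G (weakenˡ Γ Δ Σ Π (□ A)) λ h →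
    mp (byTaut ((x₂ →ᶠ x₃) →ᶠ (x₂ ∧ᶠ x₀ →ᶠ x₁) ∨ᶠ x₃) (⋀ Γ ∷ ⋁ Δ ∷ □ A ∷ □ ⟦ Σ ⇒ Π ⟧ ∷ []) refl)
       (□-antecedent {A} {Σ} {Π} h)

  4-sound : ax4 ∈ axioms L → ∀ G {Γ Δ Σ Π A} → Valid (str (G ++ [ Γ ⇒ Δ ]) (□ A ∷ Σ ⇒ Π) nothing)
            → Valid (str G (□ A ∷ Γ ⇒ Δ) (just (Σ ⇒ Π)))
  4-sound ax4∈ G {Γ} {Δ} {Σ} {Π} {A} = closing-sound G (weakenˡ Γ Δ Σ Π (□ A)) λ h →
    mp (mp (byTaut ((x₂ →ᶠ x₄) →ᶠ (x₄ →ᶠ x₃) →ᶠ (x₂ ∧ᶠ x₀ →ᶠ x₁) ∨ᶠ x₃)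
                   (⋀ Γ ∷ ⋁ Δ ∷ □ A ∷ □ ⟦ Σ ⇒ Π ⟧ ∷ □ □ A ∷ []) refl)
           (ax ax4∈ (inst4 A)))
       (□-antecedent {□ A} {Σ} {Π} h)

  5-sound : ∀ G {Γ Δ Σ Π A} → Valid (str (G ++ [ Γ ⇒ Δ ]) (Σ ⇒ □ A ∷ Π) nothing)
            → Valid (str G (Γ ⇒ □ A ∷ Δ) (just (Σ ⇒ Π)))
  5-sound G {Γ} {Δ} {Σ} {Π} {A} = closing-sound G (weakenʳ Γ Δ Σ Π (□ A)) λ h →
    mp (mp (byTaut ((x₂ ∨ᶠ x₄) →ᶠ (x₄ →ᶠ x₃) →ᶠ (x₀ →ᶠ x₂ ∨ᶠ x₁) ∨ᶠ x₃)
                   (⋀ Γ ∷ ⋁ Δ ∷ □ A ∷ □ ⟦ Σ ⇒ Π ⟧ ∷ □ ¬ᶠ □ A ∷ []) refl)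
           (ax (ax5∈ L) (inst5 A)))
       (□-mono (mp (byTaut ((x₁ →ᶠ x₀ ∨ᶠ x₂) ∨ᶠ ⊥ᶠ →ᶠ ¬ᶠ x₀ →ᶠ x₁ →ᶠ x₂) (□ A ∷ ⋀ Σ ∷ ⋁ Π ∷ []) refl) h))

  sound : ∀ {X} → L ⊢ X → Valid X
  sound (init S p Γ Δ)                 = sound₀ S (init-sound p Γ Δ)
  sound (⊥L S Γ Δ)                     = sound₀ S (⊥L-sound Γ Δ)
  sound (⊤R S Γ Δ)                     = sound₀ S (⊤R-sound Γ Δ)
  sound (¬L S {Γ} {Δ} {A} d)           = sound₁ S (¬L-sound Γ Δ A) (sound d)
  sound (¬R S {Γ} {Δ} {A} d)           = sound₁ S (¬R-sound Γ Δ A) (sound d)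
  sound (∧L S {Γ} {Δ} {A} {B} d)       = sound₁ S (∧L-sound Γ Δ A B) (sound d)
  sound (∧R S {Γ} {Δ} {A} {B} d e)     = sound₂ S (∧R-sound Γ Δ A B) (sound d) (sound e)
  sound (∨L S {Γ} {Δ} {A} {B} d e)     = sound₂ S (∨L-sound Γ Δ A B) (sound d) (sound e)
  sound (∨R S {Γ} {Δ} {A} {B} d)       = sound₁ S (∨R-sound Γ Δ A B) (sound d)
  sound (→L S {Γ} {Δ} {A} {B} d e)     = sound₂ S (→L-sound Γ Δ A B) (sound d) (sound e)
  sound (→R S {Γ} {Δ} {A} {B} d)       = sound₁ S (→R-sound Γ Δ A B) (sound d)
  sound (exch S Γ↭Γ′ Δ↭Δ′ d)           = soundS S (exch-sound Γ↭Γ′ Δ↭Δ′) (sound d)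
  sound (wkL S {Γ} {Δ} {A} d)          = soundS S (wkL-sound Γ Δ A) (sound d)
  sound (wkR S {Γ} {Δ} {A} d)          = soundS S (wkR-sound Γ Δ A) (sound d)
  sound (ctrL S {Γ} {Δ} {A} d)         = soundS S (ctrL-sound Γ Δ A) (sound d)
  sound (ctrR S {Γ} {Δ} {A} d)         = soundS S (ctrR-sound Γ Δ A) (sound d)
  sound (□R G {Γ} {Δ} {B} d)           = opening-sound G (□R-opens Γ Δ B) (sound d)
  sound (ruleP P∈ G {Γ} {Δ} d)         = opening-sound G (P-opens P∈ Γ Δ) (sound d)
  sound (ruleD D∈ G {Γ} {Δ} {A} d)     = opening-sound G (D-opens D∈ Γ Δ A) (sound d)
  sound (□L G d)                       = □L-sound G (sound d)
  sound (rule4 ax4∈ G d)               = 4-sound ax4∈ G (sound d)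
  sound (rule5 _ G d)                  = 5-sound G (sound d)
  sound (ruleC C∈ _ _)                 = ⊥-elim (monotone⇒C∉ monotone C∈)
  sound (ruleN N∈ _ _)                 = ⊥-elim (monotone⇒N∉ monotone N∈)

  soundness : ∀ {A} → L ⊢ (⇒ A) → L ⊢H A
  soundness d with sound d
  ... | final h = ⇒-sound h

nest : List Comp → Fm → Fm
nest []      Y = Y
nest (g ∷ G) Y = ⟦ g ⟧ ∨ᶠ □ nest G Y

nest-++ : ∀ G₁ G₂ Y → nest (G₁ ++ G₂) Y ≡ nest G₁ (nest G₂ Y)
nest-++ []       G₂ Y = refl
nest-++ (g ∷ G₁) G₂ Y = cong (λ Z → ⟦ g ⟧ ∨ᶠ □ Z) (nest-++ G₁ G₂ Y)

⟦_⟧ˢ : Str → Fm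
⟦ str G c m ⟧ˢ = nest G (⟦ c ⟧ ∨ᶠ ⟦ m ⟧ᵐ)

module NormalSoundness (L : Logic) (normal : isNormal L ≡ true) where
  open HilbertReasoning L
  open ComponentRules L
  open OpeningRules L

  private
    C∈ : C ∈ axioms L
    C∈ = normal⇒C∈ normal

  nec : ∀ {Y} → L ⊢H Y → L ⊢H (□ Y)
  nec {Y} h = mp (re (mp (byTaut (x₀ →ᶠ ⊤ᶠ →ᶠ x₀) (Y ∷ []) refl) h) (byTaut (x₀ →ᶠ ⊤ᶠ) (Y ∷ []) refl))
                 (ax (normal⇒N∈ normal) instN)

  ∨□-mono : ∀ {X Y Y′} → L ⊢H (Y →ᶠ Y′) → L ⊢H (X ∨ᶠ □ Y →ᶠ X ∨ᶠ □ Y′)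
  ∨□-mono {X} {Y} {Y′} h =
    mp (byTaut ((x₁ →ᶠ x₂) →ᶠ x₀ ∨ᶠ x₁ →ᶠ x₀ ∨ᶠ x₂) (X ∷ □ Y ∷ □ Y′ ∷ []) refl) (□-mono h)

  nest-nec : ∀ G {Y} → L ⊢H Y → L ⊢H nest G Y
  nest-nec []      h = h
  nest-nec (g ∷ G) {Y} h = mp (byTaut (x₁ →ᶠ x₀ ∨ᶠ x₁) (⟦ g ⟧ ∷ □ nest G Y ∷ []) refl) (nec (nest-nec G h))

  nest-mono₁ : ∀ G {Y₁ Y} → L ⊢H (Y₁ →ᶠ Y) → L ⊢H (nest G Y₁ →ᶠ nest G Y)
  nest-mono₁ []      h = h
  nest-mono₁ (g ∷ G) h = ∨□-mono (nest-mono₁ G h)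

  -- Two premisses are combined under the boxes by C.
  nest-mono₂ : ∀ G {Y₁ Y₂ Y} → L ⊢H (Y₁ →ᶠ Y₂ →ᶠ Y) → L ⊢H (nest G Y₁ →ᶠ nest G Y₂ →ᶠ nest G Y)
  nest-mono₂ []      h = h
  nest-mono₂ (g ∷ G) {Y₁} {Y₂} {Y} h =
    mp (mp (byTaut ((x₁ ∧ᶠ x₂ →ᶠ x₄) →ᶠ (x₄ →ᶠ x₃) →ᶠ x₀ ∨ᶠ x₁ →ᶠ x₀ ∨ᶠ x₂ →ᶠ x₀ ∨ᶠ x₃)
                   (⟦ g ⟧ ∷ □ N₁ ∷ □ N₂ ∷ □ N₃ ∷ □ (N₁ ∧ᶠ N₂) ∷ []) refl)
           (ax C∈ (instC N₁ N₂)))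
       (□-mono (mp (byTaut ((x₀ →ᶠ x₁ →ᶠ x₂) →ᶠ x₀ ∧ᶠ x₁ →ᶠ x₂) (N₁ ∷ N₂ ∷ N₃ ∷ []) refl) (nest-mono₂ G h)))
    where
    N₁ N₂ N₃ : Fm
    N₁ = nest G Y₁
    N₂ = nest G Y₂
    N₃ = nest G Y

  prefix : OCtx → List Comp
  prefix (inPre G₁ _ _ _) = G₁
  prefix (atLast G _)     = G

  rest : OCtx → Fm
  rest (inPre _ G₂ l m) = □ ⟦ str G₂ l m ⟧ˢ
  rest (atLast _ m)     = ⟦ m ⟧ᵐ

  ⟦plug⟧ : ∀ S c → ⟦ plug S c ⟧ˢ ≡ nest (prefix S) (⟦ c ⟧ ∨ᶠ rest S)
  ⟦plug⟧ (inPre G₁ G₂ l m) c = nest-++ G₁ (c ∷ G₂) (⟦ l ⟧ ∨ᶠ ⟦ m ⟧ᵐ)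
  ⟦plug⟧ (atLast G m)      c = refl

  private
    into : ∀ S c → L ⊢H nest (prefix S) (⟦ c ⟧ ∨ᶠ rest S) → L ⊢H ⟦ plug S c ⟧ˢ
    into S c = subst (L ⊢H_) (sym (⟦plug⟧ S c))

    outof : ∀ S c → L ⊢H ⟦ plug S c ⟧ˢ → L ⊢H nest (prefix S) (⟦ c ⟧ ∨ᶠ rest S)
    outof S c = subst (L ⊢H_) (⟦plug⟧ S c)

  sound₀ : ∀ S {c} → Sound₀ c → L ⊢H ⟦ plug S c ⟧ˢ
  sound₀ S {c} r = into S c (nest-nec (prefix S) (r (rest S)))

  sound₁ : ∀ S {c₁ c} → Sound₁ c₁ c → L ⊢H ⟦ plug S c₁ ⟧ˢ → L ⊢H ⟦ plug S c ⟧ˢ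
  sound₁ S {c₁} {c} r h = into S c (mp (nest-mono₁ (prefix S) (r (rest S))) (outof S c₁ h))

  sound₂ : ∀ S {c₁ c₂ c} → Sound₂ c₁ c₂ c
           → L ⊢H ⟦ plug S c₁ ⟧ˢ → L ⊢H ⟦ plug S c₂ ⟧ˢ → L ⊢H ⟦ plug S c ⟧ˢ
  sound₂ S {c₁} {c₂} {c} r h₁ h₂ =
    into S c (mp (mp (nest-mono₂ (prefix S) (r (rest S))) (outof S c₁ h₁)) (outof S c₂ h₂))

  soundS : ∀ S {c₁ c} → Sound₁ c₁ c → L ⊢H ⟦ plugS S c₁ ⟧ˢ → L ⊢H ⟦ plugS S c ⟧ˢ
  soundS (ord S)   r h = sound₁ S r h
  soundS (inM G _) {c₁} {c} r h = mp (nest-mono₁ G (∨□-mono (Sound₁-implication {c₁} {c} r))) h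

  unfold-last : ∀ G c₀ c m → L ⊢H ⟦ str (G ++ [ c₀ ]) c m ⟧ˢ → L ⊢H nest G (⟦ c₀ ⟧ ∨ᶠ □ (⟦ c ⟧ ∨ᶠ ⟦ m ⟧ᵐ))
  unfold-last G c₀ c m = subst (L ⊢H_) (nest-++ G [ c₀ ] (⟦ c ⟧ ∨ᶠ ⟦ m ⟧ᵐ))

  -- The closing rules push a formula F under the box of the m-component; C merges
  -- □ F with the boxed premiss.
  private
    merge : ∀ F Z → L ⊢H (□ F ∧ᶠ □ Z →ᶠ □ (F ∧ᶠ Z))
    merge F Z = ax C∈ (instC F Z)

  □L-closes : ∀ Γ Δ Σ Π A
              → L ⊢H (⟦ Γ ⇒ Δ ⟧ ∨ᶠ □ (⟦ A ∷ Σ ⇒ Π ⟧ ∨ᶠ ⊥ᶠ) →ᶠ ⟦ □ A ∷ Γ ⇒ Δ ⟧ ∨ᶠ □ ⟦ Σ ⇒ Π ⟧)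
  □L-closes Γ Δ Σ Π A =
    mp (mp (byTaut ((x₂ ∧ᶠ x₄ →ᶠ x₅) →ᶠ (x₅ →ᶠ x₃) →ᶠ (x₀ →ᶠ x₁) ∨ᶠ x₄ →ᶠ (x₂ ∧ᶠ x₀ →ᶠ x₁) ∨ᶠ x₃)
                   (⋀ Γ ∷ ⋁ Δ ∷ □ A ∷ □ Y ∷ □ Z ∷ □ (A ∧ᶠ Z) ∷ []) refl)
           (merge A Z))
       (□-mono (byTaut (x₀ ∧ᶠ ((x₀ ∧ᶠ x₁ →ᶠ x₂) ∨ᶠ ⊥ᶠ) →ᶠ x₁ →ᶠ x₂) (A ∷ ⋀ Σ ∷ ⋁ Π ∷ []) refl))
    where
    Y Z : Fm
    Y = ⟦ Σ ⇒ Π ⟧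
    Z = ⟦ A ∷ Σ ⇒ Π ⟧ ∨ᶠ ⊥ᶠ

  4-closes : ax4 ∈ axioms L → ∀ Γ Δ Σ Π A
             → L ⊢H (⟦ Γ ⇒ Δ ⟧ ∨ᶠ □ (⟦ □ A ∷ Σ ⇒ Π ⟧ ∨ᶠ ⊥ᶠ) →ᶠ ⟦ □ A ∷ Γ ⇒ Δ ⟧ ∨ᶠ □ ⟦ Σ ⇒ Π ⟧)
  4-closes ax4∈ Γ Δ Σ Π A =
    mp (mp (mp (byTaut ((x₂ →ᶠ x₆) →ᶠ (x₆ ∧ᶠ x₄ →ᶠ x₅) →ᶠ (x₅ →ᶠ x₃)
                          →ᶠ (x₀ →ᶠ x₁) ∨ᶠ x₄ →ᶠ (x₂ ∧ᶠ x₀ →ᶠ x₁) ∨ᶠ x₃)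
                       (⋀ Γ ∷ ⋁ Δ ∷ □ A ∷ □ Y ∷ □ Z ∷ □ (□ A ∧ᶠ Z) ∷ □ □ A ∷ []) refl)
               (ax ax4∈ (inst4 A)))
           (merge (□ A) Z))
       (□-mono (byTaut (x₀ ∧ᶠ ((x₀ ∧ᶠ x₁ →ᶠ x₂) ∨ᶠ ⊥ᶠ) →ᶠ x₁ →ᶠ x₂) (□ A ∷ ⋀ Σ ∷ ⋁ Π ∷ []) refl))
    where
    Y Z : Fm
    Y = ⟦ Σ ⇒ Π ⟧
    Z = ⟦ □ A ∷ Σ ⇒ Π ⟧ ∨ᶠ ⊥ᶠ

  5-closes : ∀ Γ Δ Σ Π A
             → L ⊢H (⟦ Γ ⇒ Δ ⟧ ∨ᶠ □ (⟦ Σ ⇒ □ A ∷ Π ⟧ ∨ᶠ ⊥ᶠ) →ᶠ ⟦ Γ ⇒ □ A ∷ Δ ⟧ ∨ᶠ □ ⟦ Σ ⇒ Π ⟧)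
  5-closes Γ Δ Σ Π A =
    mp (mp (mp (byTaut (x₂ ∨ᶠ x₆ →ᶠ (x₆ ∧ᶠ x₄ →ᶠ x₅) →ᶠ (x₅ →ᶠ x₃)
                          →ᶠ (x₀ →ᶠ x₁) ∨ᶠ x₄ →ᶠ (x₀ →ᶠ x₂ ∨ᶠ x₁) ∨ᶠ x₃)
                       (⋀ Γ ∷ ⋁ Δ ∷ □ A ∷ □ Y ∷ □ Z ∷ □ (¬ᶠ □ A ∧ᶠ Z) ∷ □ ¬ᶠ □ A ∷ []) refl)
               (ax (ax5∈ L) (inst5 A)))
           (merge (¬ᶠ □ A) Z))
       (□-mono (byTaut (¬ᶠ x₀ ∧ᶠ ((x₁ →ᶠ x₀ ∨ᶠ x₂) ∨ᶠ ⊥ᶠ) →ᶠ x₁ →ᶠ x₂) (□ A ∷ ⋀ Σ ∷ ⋁ Π ∷ []) refl))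
    where
    Y Z : Fm
    Y = ⟦ Σ ⇒ Π ⟧
    Z = ⟦ Σ ⇒ □ A ∷ Π ⟧ ∨ᶠ ⊥ᶠ

  sound : ∀ {X} → L ⊢ X → L ⊢H ⟦ X ⟧ˢ
  sound (init S p Γ Δ)             = sound₀ S (init-sound p Γ Δ)
  sound (⊥L S Γ Δ)                 = sound₀ S (⊥L-sound Γ Δ)
  sound (⊤R S Γ Δ)                 = sound₀ S (⊤R-sound Γ Δ)
  sound (¬L S {Γ} {Δ} {A} d)       = sound₁ S (¬L-sound Γ Δ A) (sound d)
  sound (¬R S {Γ} {Δ} {A} d)       = sound₁ S (¬R-sound Γ Δ A) (sound d)
  sound (∧L S {Γ} {Δ} {A} {B} d)   = sound₁ S (∧L-sound Γ Δ A B) (sound d)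
  sound (∧R S {Γ} {Δ} {A} {B} d e) = sound₂ S (∧R-sound Γ Δ A B) (sound d) (sound e)
  sound (∨L S {Γ} {Δ} {A} {B} d e) = sound₂ S (∨L-sound Γ Δ A B) (sound d) (sound e)
  sound (∨R S {Γ} {Δ} {A} {B} d)   = sound₁ S (∨R-sound Γ Δ A B) (sound d)
  sound (→L S {Γ} {Δ} {A} {B} d e) = sound₂ S (→L-sound Γ Δ A B) (sound d) (sound e)
  sound (→R S {Γ} {Δ} {A} {B} d)   = sound₁ S (→R-sound Γ Δ A B) (sound d)
  sound (exch S Γ↭Γ′ Δ↭Δ′ d)       = soundS S (exch-sound Γ↭Γ′ Δ↭Δ′) (sound d)
  sound (wkL S {Γ} {Δ} {A} d)      = soundS S (wkL-sound Γ Δ A) (sound d)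
  sound (wkR S {Γ} {Δ} {A} d)      = soundS S (wkR-sound Γ Δ A) (sound d)
  sound (ctrL S {Γ} {Δ} {A} d)     = soundS S (ctrL-sound Γ Δ A) (sound d)
  sound (ctrR S {Γ} {Δ} {A} d)     = soundS S (ctrR-sound Γ Δ A) (sound d)
  sound (□R G {Γ} {Δ} {B} d)       = mp (nest-mono₁ G (□R-opens Γ Δ B)) (sound d)
  sound (ruleD D∈ G {Γ} {Δ} {A} d) = mp (nest-mono₁ G (D-opens D∈ Γ Δ A)) (sound d)
  sound (ruleP P∈ _ _)             = ⊥-elim (normal⇒P∉ normal P∈)
  sound (□L G {Γ} {Δ} {Σ} {Π} {A} d) =
    mp (nest-mono₁ G (□L-closes Γ Δ Σ Π A)) (unfold-last G (Γ ⇒ Δ) (A ∷ Σ ⇒ Π) nothing (sound d))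
  sound (rule4 ax4∈ G {Γ} {Δ} {Σ} {Π} {A} d) =
    mp (nest-mono₁ G (4-closes ax4∈ Γ Δ Σ Π A)) (unfold-last G (Γ ⇒ Δ) (□ A ∷ Σ ⇒ Π) nothing (sound d))
  sound (rule5 _ G {Γ} {Δ} {Σ} {Π} {A} d) =
    mp (nest-mono₁ G (5-closes Γ Δ Σ Π A)) (unfold-last G (Γ ⇒ Δ) (Σ ⇒ □ A ∷ Π) nothing (sound d))
  sound (ruleC _ G {c₀} {c} d) =
    subst (L ⊢H_) (sym (nest-++ G [ c₀ ] (⟦ c ⟧ ∨ᶠ ⊥ᶠ)))
          (mp (nest-mono₁ G (∨□-mono (byTaut (x₀ →ᶠ x₀ ∨ᶠ ⊥ᶠ) (⟦ c ⟧ ∷ []) refl))) (sound d))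
  sound (ruleN _ G {c₀} {c} d) =
    mp (nest-mono₁ G (∨□-mono (byTaut (x₀ ∨ᶠ ⊥ᶠ →ᶠ x₀) (⟦ c ⟧ ∷ []) refl))) (unfold-last G c₀ c nothing (sound d))

  soundness : ∀ {A} → L ⊢ (⇒ A) → L ⊢H A
  soundness d = ⇒-sound (sound d)

++-⊆ : ∀ {xs ys zs : List Fm} → xs ⊆ zs → ys ⊆ zs → xs ++ ys ⊆ zs
++-⊆ {xs} s t p = [ s , t ]′ (∈-++⁻ xs p)

++-idem : ∀ (xs ys : List Fm) → xs ++ xs ++ ys ⊆ xs ++ ys
++-idem xs ys = ++-⊆ (xs⊆xs++ys xs ys) ⊆-refl

to-front : ∀ xs {F : Fm} {ys} → xs ++ F ∷ ys ⊆ F ∷ xs ++ ys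
to-front xs {F} {ys} = ⊆-reflexive-↭ (shift F xs ys)

from-front : ∀ xs {F : Fm} {ys} → F ∷ xs ++ ys ⊆ xs ++ F ∷ ys
from-front xs {F} {ys} = ⊆-reflexive-↭ (↭-sym (shift F xs ys))

swap-⊆ : ∀ {F G : Fm} {xs} → F ∷ G ∷ xs ⊆ G ∷ F ∷ xs
swap-⊆ {F} {G} = ⊆-reflexive-↭ (↭-swap F G ↭-refl)

swap-++ : ∀ (xs ys zs : List Fm) → xs ++ ys ++ zs ⊆ ys ++ xs ++ zs
swap-++ xs ys zs = ⊆-reflexive-↭ (shifts xs ys)

premiss-⊆ : ∀ Θ Γ′ {F : Fm} {Γ} → Θ ++ Γ′ ++ Γ ⊆ Γ′ ++ Θ ++ F ∷ Γ
premiss-⊆ Θ Γ′ {F} {Γ} = ⊆-trans (swap-++ Θ Γ′ Γ) (++⁺ʳ Γ′ (++⁺ʳ Θ (xs⊆x∷xs Γ F)))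

isCompound : Fm → Bool
isCompound (var _) = false
isCompound (□ _)   = false
isCompound _       = true

compound-≢□ : ∀ {F A} → isCompound F ≡ true → F ≢ □ A
compound-≢□ () refl

compound-≢var : ∀ {F p} → isCompound F ≡ true → F ≢ var p
compound-≢var () refl

-- A premiss of a propositional rule, given by the formulas it adds on the left and
-- on the right.
Premiss : Set
Premiss = List Fm × List Fm

leftPremisses : Fm → List Premiss
leftPremisses ⊤ᶠ       = ([] , []) ∷ []
leftPremisses (¬ᶠ A)   = ([] , A ∷ []) ∷ []
leftPremisses (A ∧ᶠ B) = (A ∷ B ∷ [] , []) ∷ []
leftPremisses (A ∨ᶠ B) = (A ∷ [] , []) ∷ (B ∷ [] , []) ∷ []
leftPremisses (A →ᶠ B) = ([] , A ∷ []) ∷ (B ∷ [] , []) ∷ []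
leftPremisses _        = []

rightPremisses : Fm → List Premiss
rightPremisses ⊥ᶠ       = ([] , []) ∷ []
rightPremisses (¬ᶠ A)   = (A ∷ [] , []) ∷ []
rightPremisses (A ∧ᶠ B) = ([] , A ∷ []) ∷ ([] , B ∷ []) ∷ []
rightPremisses (A ∨ᶠ B) = ([] , A ∷ B ∷ []) ∷ []
rightPremisses (A →ᶠ B) = (A ∷ [] , B ∷ []) ∷ []
rightPremisses _        = []

unboxed : Fm → Maybe Fm
unboxed (□ A) = just A
unboxed _     = nothing

unboxed-just : ∀ {F A} → unboxed F ≡ just A → F ≡ □ A
unboxed-just {□ A} refl = refl

unbox : List Fm → List Fm
unbox []      = []
unbox (F ∷ Γ) with unboxed F
... | just A  = A ∷ unbox Γ
... | nothing = unbox Γ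

boxes : List Fm → List Fm
boxes Γ = map □_ (unbox Γ)

∈-unbox⁺ : ∀ {A Γ} → □ A ∈ Γ → A ∈ unbox Γ
∈-unbox⁺ (here refl) = here refl
∈-unbox⁺ {Γ = F ∷ Γ} (there p) with unboxed F
... | just _  = there (∈-unbox⁺ p)
... | nothing = ∈-unbox⁺ p

∈-unbox⁻ : ∀ Γ {A} → A ∈ unbox Γ → □ A ∈ Γ
∈-unbox⁻ (F ∷ Γ) p with unboxed F in eq
∈-unbox⁻ (F ∷ Γ) (here refl) | just _ with refl ← unboxed-just eq = here refl
∈-unbox⁻ (F ∷ Γ) (there p)   | just _  = there (∈-unbox⁻ Γ p)
∈-unbox⁻ (F ∷ Γ) p           | nothing = there (∈-unbox⁻ Γ p)

∈-boxes⁺ : ∀ {A Γ} → □ A ∈ Γ → □ A ∈ boxes Γ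
∈-boxes⁺ p = ∈-map⁺ □_ (∈-unbox⁺ p)

∈-boxes⁻ : ∀ Γ {F} → F ∈ boxes Γ → ∃ λ A → F ≡ □ A × □ A ∈ Γ
∈-boxes⁻ Γ p with A , A∈ , refl ← ∈-map⁻ □_ p = A , refl , ∈-unbox⁻ Γ A∈

boxes⊆ : ∀ Γ → boxes Γ ⊆ Γ
boxes⊆ Γ p with _ , refl , □A∈ ← ∈-boxes⁻ Γ p = □A∈

infix 4 _⊆□_
_⊆□_ : List Fm → List Fm → Set
Γ ⊆□ Γ′ = ∀ {A} → □ A ∈ Γ → □ A ∈ Γ′

unbox-mono : ∀ {Γ Γ′} → Γ ⊆□ Γ′ → unbox Γ ⊆ unbox Γ′
unbox-mono {Γ} s p = ∈-unbox⁺ (s (∈-unbox⁻ Γ p))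

boxes-mono : ∀ {Γ Γ′} → Γ ⊆□ Γ′ → boxes Γ ⊆ boxes Γ′
boxes-mono {Γ} s p with _ , refl , □A∈ ← ∈-boxes⁻ Γ p = ∈-boxes⁺ (s □A∈)

boxes-⊆□ : ∀ Γ → Γ ⊆□ boxes Γ
boxes-⊆□ Γ = ∈-boxes⁺

compound-⊆□ : ∀ {F Γ Γ′} → isCompound F ≡ true → Γ ⊆ F ∷ Γ′ → Γ ⊆□ Γ′
compound-⊆□ c s p with s p
... | here eq = ⊥-elim (compound-≢□ c (sym eq))
... | there q = q

boxFree-or-box : ∀ Γ → (∃ λ A → □ A ∈ Γ) ⊎ unbox Γ ≡ []
boxFree-or-box Γ with unbox Γ in eq
... | []    = inj₂ refl
... | A ∷ _ = inj₁ (A , ∈-unbox⁻ Γ (subst (A ∈_) (sym eq) (here refl)))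

no-unbox-⊆ : ∀ Γ {Θ} → unbox Γ ≡ [] → unbox Γ ++ boxes Γ ⊆ Θ
no-unbox-⊆ Γ eq {F} p with () ← subst (λ As → F ∈ As ++ map □_ As) eq p

var∷-⊆□ : ∀ {p Δ} → var p ∷ Δ ⊆□ Δ
var∷-⊆□ (there q) = q

-- A monotone jump reads the LNS rules bottom-up: an opener (□R, P or D) creates
-- the m-component and a closer (□L, 4 or 5) fills it and turns it into an
-- ordinary component.  The jump's premiss is that new component.
data Opener : Set where
  open□R : Fm → Opener
  openP  : Opener
  openD  : Fm → Opener

data Closer : Set where
  close□L close4 close5 : Fm → Closer

openerˡ openerʳ : Opener → List Fm
openerˡ (open□R _) = []
openerˡ openP      = []
openerˡ (openD A)  = A ∷ []
openerʳ (open□R B) = B ∷ []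
openerʳ openP      = []
openerʳ (openD _)  = []

closerˡ closerʳ : Closer → List Fm
closerˡ (close□L A) = A ∷ []
closerˡ (close4 A)  = □ A ∷ []
closerˡ (close5 _)  = []
closerʳ (close□L _) = []
closerʳ (close4 _)  = []
closerʳ (close5 A)  = □ A ∷ []

module Calculus (L : Logic) where

  OpenerAllowed : Opener → Set
  OpenerAllowed (open□R _) = ⊤
  OpenerAllowed openP      = P ∈ axioms L
  OpenerAllowed (openD _)  = D ∈ axioms L

  CloserAllowed : Closer → Set
  CloserAllowed (close4 _) = ax4 ∈ axioms L
  CloserAllowed _          = ⊤

  OpenerFits : Opener → List Fm → List Fm → Set
  OpenerFits (open□R B) Γ Δ = □ B ∈ Δ
  OpenerFits openP      Γ Δ = ⊤
  OpenerFits (openD A)  Γ Δ = □ A ∈ Γ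

  CloserFits : Closer → List Fm → List Fm → Set
  CloserFits (close□L A) Γ Δ = □ A ∈ Γ
  CloserFits (close4 A)  Γ Δ = □ A ∈ Γ
  CloserFits (close5 A)  Γ Δ = □ A ∈ Δ

  openerFits-⊆□ : ∀ {Γ Δ Γ′ Δ′} → Γ ⊆□ Γ′ → Δ ⊆□ Δ′ → ∀ o → OpenerFits o Γ Δ → OpenerFits o Γ′ Δ′
  openerFits-⊆□ f g (open□R _) p = g p
  openerFits-⊆□ f g openP      p = tt
  openerFits-⊆□ f g (openD _)  p = f p

  closerFits-⊆□ : ∀ {Γ Δ Γ′ Δ′} → Γ ⊆□ Γ′ → Δ ⊆□ Δ′ → ∀ c → CloserFits c Γ Δ → CloserFits c Γ′ Δ′
  closerFits-⊆□ f g (close□L _) p = f p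
  closerFits-⊆□ f g (close4 _)  p = f p
  closerFits-⊆□ f g (close5 _)  p = g p

  -- In the normal logics N and C let a jump keep every boxed formula of its conclusion.
  data NormalOpener (Γ Δ : List Fm) : Set where
    nopen□R : ∀ B → □ B ∈ Δ → NormalOpener Γ Δ
    nopenD  : ∀ A → □ A ∈ Γ → D ∈ axioms L → NormalOpener Γ Δ

  nopenerʳ : ∀ {Γ Δ} → NormalOpener Γ Δ → List Fm
  nopenerʳ (nopen□R B _) = B ∷ []
  nopenerʳ (nopenD _ _ _) = []

  infix 3 _⊢[_]_ _⊩_
  data _⊢[_]_ : List Fm → ℕ → List Fm → Set where
    axiom : ∀ {n Γ Δ p} → var p ∈ Γ → var p ∈ Δ → Γ ⊢[ n ] Δ
    compL : ∀ {n Γ Δ F} → isCompound F ≡ true → F ∈ Γ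
            → (∀ {q} → q ∈ leftPremisses F → proj₁ q ++ Γ ⊢[ n ] proj₂ q ++ Δ)
            → Γ ⊢[ suc n ] Δ
    compR : ∀ {n Γ Δ F} → isCompound F ≡ true → F ∈ Δ
            → (∀ {q} → q ∈ rightPremisses F → proj₁ q ++ Γ ⊢[ n ] proj₂ q ++ Δ)
            → Γ ⊢[ suc n ] Δ
    jumpM : ∀ {n Γ Δ} → isNormal L ≡ false → ∀ o c → OpenerAllowed o → CloserAllowed c
            → OpenerFits o Γ Δ → CloserFits c Γ Δ
            → closerˡ c ++ openerˡ o ⊢[ n ] closerʳ c ++ openerʳ o
            → Γ ⊢[ suc n ] Δ
    jumpN : ∀ {n Γ Δ} → isNormal L ≡ true → (o : NormalOpener Γ Δ)
            → unbox Γ ++ boxes Γ ⊢[ n ] boxes Δ ++ nopenerʳ o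
            → Γ ⊢[ suc n ] Δ

  _⊩_ : List Fm → List Fm → Set
  Γ ⊩ Δ = ∃ λ n → Γ ⊢[ n ] Δ

  height-mono : ∀ {m n Γ Δ} → m ≤ n → Γ ⊢[ m ] Δ → Γ ⊢[ n ] Δ
  height-mono _         (axiom a b)                 = axiom a b
  height-mono (s≤s m≤n) (compL c F∈ ds)             = compL c F∈ (λ i → height-mono m≤n (ds i))
  height-mono (s≤s m≤n) (compR c F∈ ds)             = compR c F∈ (λ i → height-mono m≤n (ds i))
  height-mono (s≤s m≤n) (jumpM e o c ao ac fo fc d) = jumpM e o c ao ac fo fc (height-mono m≤n d)
  height-mono (s≤s m≤n) (jumpN e o d)               = jumpN e o (height-mono m≤n d)

  unbox++boxes-mono : ∀ {Γ Γ′} → Γ ⊆□ Γ′ → unbox Γ ++ boxes Γ ⊆ unbox Γ′ ++ boxes Γ′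
  unbox++boxes-mono s = ⊆.++⁺ (unbox-mono s) (boxes-mono s)

  -- Along ⊆, which ignores multiplicities, this is weakening and contraction at once.
  weaken : ∀ {n Γ Δ Γ′ Δ′} → Γ ⊆ Γ′ → Δ ⊆ Δ′ → Γ ⊢[ n ] Δ → Γ′ ⊢[ n ] Δ′

  jumpN-⊆□ : ∀ {n Γ Δ Γ′ Δ′} → Γ ⊆□ Γ′ → Δ ⊆□ Δ′ → isNormal L ≡ true → (o : NormalOpener Γ Δ)
             → unbox Γ ++ boxes Γ ⊢[ n ] boxes Δ ++ nopenerʳ o → Γ′ ⊢[ suc n ] Δ′
  jumpN-⊆□ f g e (nopen□R B p) d =
    jumpN e (nopen□R B (g p)) (weaken (unbox++boxes-mono f) (++⁺ˡ (B ∷ []) (boxes-mono g)) d)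
  jumpN-⊆□ f g e (nopenD A p D∈) d =
    jumpN e (nopenD A (f p) D∈) (weaken (unbox++boxes-mono f) (++⁺ˡ [] (boxes-mono g)) d)

  weaken s t (axiom a b) = axiom (s a) (t b)
  weaken s t (compL c F∈ ds) =
    compL c (s F∈) λ {q} i → weaken (++⁺ʳ (proj₁ q) s) (++⁺ʳ (proj₂ q) t) (ds i)
  weaken s t (compR c F∈ ds) =
    compR c (t F∈) λ {q} i → weaken (++⁺ʳ (proj₁ q) s) (++⁺ʳ (proj₂ q) t) (ds i)
  weaken s t (jumpM e o c ao ac fo fc d) =
    jumpM e o c ao ac (openerFits-⊆□ s t o fo) (closerFits-⊆□ s t c fc) d
  weaken s t (jumpN e o d) = jumpN-⊆□ s t e o d

  weaken⊩ : ∀ {Γ Δ Γ′ Δ′} → Γ ⊆ Γ′ → Δ ⊆ Δ′ → Γ ⊩ Δ → Γ′ ⊩ Δ′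
  weaken⊩ s t (n , d) = n , weaken s t d

  jumpM-⊆□ : ∀ {n Γ Δ Γ′ Δ′} → Γ ⊆□ Γ′ → Δ ⊆□ Δ′ → isNormal L ≡ false → ∀ o c
             → OpenerAllowed o → CloserAllowed c → OpenerFits o Γ Δ → CloserFits c Γ Δ
             → closerˡ c ++ openerˡ o ⊢[ n ] closerʳ c ++ openerʳ o → Γ′ ⊢[ suc n ] Δ′
  jumpM-⊆□ f g e o c ao ac fo fc = jumpM e o c ao ac (openerFits-⊆□ f g o fo) (closerFits-⊆□ f g c fc)

  commonHeight : ∀ (R : Premiss → ℕ → Set) → (∀ {q m n} → m ≤ n → R q m → R q n) → ∀ qs
                 → (∀ {q} → q ∈ qs → ∃ (R q)) → ∃ λ n → ∀ {q} → q ∈ qs → R q n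
  commonHeight R mono []       hs = 0 , λ ()
  commonHeight R mono (q ∷ qs) hs with hs (here refl) | commonHeight R mono qs (hs ∘ there)
  ... | m , h | n , hs′ = m ⊔ n , λ { (here refl) → mono (m≤m⊔n m n) h ; (there i) → mono (m≤n⊔m m n) (hs′ i) }

  compL⊩ : ∀ {Γ Δ F} → isCompound F ≡ true → F ∈ Γ
           → (∀ {q} → q ∈ leftPremisses F → proj₁ q ++ Γ ⊩ proj₂ q ++ Δ) → Γ ⊩ Δ
  compL⊩ {Γ} {Δ} {F} c F∈ ds
    with n , ds′ ← commonHeight (λ q n → proj₁ q ++ Γ ⊢[ n ] proj₂ q ++ Δ) height-mono (leftPremisses F) ds
    = suc n , compL c F∈ ds′

  compR⊩ : ∀ {Γ Δ F} → isCompound F ≡ true → F ∈ Δ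
           → (∀ {q} → q ∈ rightPremisses F → proj₁ q ++ Γ ⊩ proj₂ q ++ Δ) → Γ ⊩ Δ
  compR⊩ {Γ} {Δ} {F} c F∈ ds
    with n , ds′ ← commonHeight (λ q n → proj₁ q ++ Γ ⊢[ n ] proj₂ q ++ Δ) height-mono (rightPremisses F) ds
    = suc n , compR c F∈ ds′

  jumpM⊩ : ∀ {Γ Δ} → isNormal L ≡ false → ∀ o c → OpenerAllowed o → CloserAllowed c
           → OpenerFits o Γ Δ → CloserFits c Γ Δ
           → closerˡ c ++ openerˡ o ⊩ closerʳ c ++ openerʳ o → Γ ⊩ Δ
  jumpM⊩ e o c ao ac fo fc (n , d) = suc n , jumpM e o c ao ac fo fc d

  jumpN⊩ : ∀ {Γ Δ} → isNormal L ≡ true → (o : NormalOpener Γ Δ)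
           → unbox Γ ++ boxes Γ ⊩ boxes Δ ++ nopenerʳ o → Γ ⊩ Δ
  jumpN⊩ e o (n , d) = suc n , jumpN e o d

  invertʳ : ∀ {n Γ Δ′ Δ F} → isCompound F ≡ true → Γ ⊢[ n ] Δ′ → Δ′ ⊆ F ∷ Δ
            → ∀ {q} → q ∈ rightPremisses F → proj₁ q ++ Γ ⊩ proj₂ q ++ Δ
  invertʳ c (axiom a b) s {q} i with s b
  ... | here eq  = ⊥-elim (compound-≢var c (sym eq))
  ... | there b′ = 0 , axiom (∈-++⁺ʳ (proj₁ q) a) (∈-++⁺ʳ (proj₂ q) b′)
  invertʳ c (compL c′ G∈ ds) s {q} i =
    compL⊩ c′ (∈-++⁺ʳ (proj₁ q) G∈) λ {q′} i′ →
      weaken⊩ (swap-++ (proj₁ q) (proj₁ q′) _) (swap-++ (proj₂ q) (proj₂ q′) _)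
              (invertʳ c (ds i′) (⊆-trans (++⁺ʳ (proj₂ q′) s) (to-front (proj₂ q′))) i)
  invertʳ c (compR c′ G∈ ds) s {q} i with s G∈
  ... | here refl =
    weaken⊩ (++-idem (proj₁ q) _) (++-idem (proj₂ q) _)
            (invertʳ c (ds i) (⊆-trans (++⁺ʳ (proj₂ q) s) (to-front (proj₂ q))) i)
  ... | there G∈′ =
    compR⊩ c′ (∈-++⁺ʳ (proj₂ q) G∈′) λ {q′} i′ →
      weaken⊩ (swap-++ (proj₁ q) (proj₁ q′) _) (swap-++ (proj₂ q) (proj₂ q′) _)
              (invertʳ c (ds i′) (⊆-trans (++⁺ʳ (proj₂ q′) s) (to-front (proj₂ q′))) i)
  invertʳ c (jumpM e o c′ ao ac fo fc d) s {q} i =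
    _ , jumpM-⊆□ (∈-++⁺ʳ (proj₁ q)) (∈-++⁺ʳ (proj₂ q) ∘ compound-⊆□ c s) e o c′ ao ac fo fc d
  invertʳ c (jumpN e o d) s {q} i =
    _ , jumpN-⊆□ (∈-++⁺ʳ (proj₁ q)) (∈-++⁺ʳ (proj₂ q) ∘ compound-⊆□ c s) e o d

  invertˡ : ∀ {n Γ′ Γ Δ F} → isCompound F ≡ true → Γ′ ⊢[ n ] Δ → Γ′ ⊆ F ∷ Γ
            → ∀ {q} → q ∈ leftPremisses F → proj₁ q ++ Γ ⊩ proj₂ q ++ Δ
  invertˡ c (axiom a b) s {q} i with s a
  ... | here eq  = ⊥-elim (compound-≢var c (sym eq))
  ... | there a′ = 0 , axiom (∈-++⁺ʳ (proj₁ q) a′) (∈-++⁺ʳ (proj₂ q) b)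
  invertˡ c (compR c′ G∈ ds) s {q} i =
    compR⊩ c′ (∈-++⁺ʳ (proj₂ q) G∈) λ {q′} i′ →
      weaken⊩ (swap-++ (proj₁ q) (proj₁ q′) _) (swap-++ (proj₂ q) (proj₂ q′) _)
              (invertˡ c (ds i′) (⊆-trans (++⁺ʳ (proj₁ q′) s) (to-front (proj₁ q′))) i)
  invertˡ c (compL c′ G∈ ds) s {q} i with s G∈
  ... | here refl =
    weaken⊩ (++-idem (proj₁ q) _) (++-idem (proj₂ q) _)
            (invertˡ c (ds i) (⊆-trans (++⁺ʳ (proj₁ q) s) (to-front (proj₁ q))) i)
  ... | there G∈′ =
    compL⊩ c′ (∈-++⁺ʳ (proj₁ q) G∈′) λ {q′} i′ →
      weaken⊩ (swap-++ (proj₁ q) (proj₁ q′) _) (swap-++ (proj₂ q) (proj₂ q′) _)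
              (invertˡ c (ds i′) (⊆-trans (++⁺ʳ (proj₁ q′) s) (to-front (proj₁ q′))) i)
  invertˡ c (jumpM e o c′ ao ac fo fc d) s {q} i =
    _ , jumpM-⊆□ (∈-++⁺ʳ (proj₁ q) ∘ compound-⊆□ c s) (∈-++⁺ʳ (proj₂ q)) e o c′ ao ac fo fc d
  invertˡ c (jumpN e o d) s {q} i =
    _ , jumpN-⊆□ (∈-++⁺ʳ (proj₁ q) ∘ compound-⊆□ c s) (∈-++⁺ʳ (proj₂ q)) e o d

module Cut (L : Logic) where
  open Calculus L

  monotone-and-normal : ∀ {A : Set} → isNormal L ≡ false → isNormal L ≡ true → A
  monotone-and-normal m n with () ← trans (sym m) n

  -- What a jump leaves behind once the cut formula is taken out: an optional closer.
  data Residue (Γ Δ : List Fm) : Set where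
    none : Residue Γ Δ
    some : ∀ c → CloserFits c Γ Δ → Residue Γ Δ

  residueˡ residueʳ : ∀ {Γ Δ} → Residue Γ Δ → List Fm
  residueˡ none       = []
  residueˡ (some c _) = closerˡ c
  residueʳ none       = []
  residueʳ (some c _) = closerʳ c

  ResidueAllowed : ∀ {Γ Δ} → Residue Γ Δ → Set
  ResidueAllowed none       = ⊤
  ResidueAllowed (some c _) = CloserAllowed c

  residueAllowed-4 : ∀ {Γ Δ} → ax4 ∈ axioms L → (r : Residue Γ Δ) → ResidueAllowed r
  residueAllowed-4 ax4∈ none                = tt
  residueAllowed-4 ax4∈ (some (close□L _) _) = tt
  residueAllowed-4 ax4∈ (some (close4 _) _)  = ax4∈
  residueAllowed-4 ax4∈ (some (close5 _) _)  = tt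

  -- How a monotone jump concluding Γ ⇒ □ Z, Δ uses □ Z: as the formula of the
  -- closer 5, or as the formula of the opener □R.
  data □RPremiss (Z : Fm) (Γ Δ : List Fm) (k : ℕ) : Set where
    self5  : [] ⊢[ k ] □ Z ∷ Z ∷ [] → □RPremiss Z Γ Δ k
    closer : ∀ c → CloserAllowed c → CloserFits c Γ Δ
             → closerˡ c ++ [] ⊢[ k ] closerʳ c ++ Z ∷ [] → □RPremiss Z Γ Δ k

  data LeftJump (Z : Fm) (Γ Δ : List Fm) (k : ℕ) : Set where
    by5  : ∀ o → OpenerAllowed o → OpenerFits o Γ Δ
           → openerˡ o ⊢[ k ] □ Z ∷ openerʳ o → LeftJump Z Γ Δ k
    by□R : □RPremiss Z Γ Δ k → (r : Residue Γ Δ)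
           → residueˡ r ⊢[ suc k ] □ Z ∷ residueʳ r → LeftJump Z Γ Δ k

  -- How a monotone jump concluding □ Z, Γ ⇒ Δ uses □ Z: as the formula of the
  -- opener D, or as the formula of the closer □L or 4.
  data DPremiss (Z : Fm) (Γ Δ : List Fm) (k : ℕ) : Set where
    self4  : ax4 ∈ axioms L → □ Z ∷ Z ∷ [] ⊢[ k ] [] → DPremiss Z Γ Δ k
    self□L : Z ∷ Z ∷ [] ⊢[ k ] [] → DPremiss Z Γ Δ k
    closer : ∀ c → CloserAllowed c → CloserFits c Γ Δ
             → closerˡ c ++ Z ∷ [] ⊢[ k ] closerʳ c ++ [] → DPremiss Z Γ Δ k

  data CloserPremiss (Z : Fm) (o : Opener) (k : ℕ) : Set where
    by□L : Z ∷ openerˡ o ⊢[ k ] openerʳ o → CloserPremiss Z o k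
    by4  : ax4 ∈ axioms L → □ Z ∷ openerˡ o ⊢[ k ] openerʳ o → CloserPremiss Z o k

  data RightJump (Z : Fm) (Γ Δ : List Fm) (k : ℕ) : Set where
    byD      : D ∈ axioms L → DPremiss Z Γ Δ k → RightJump Z Γ Δ k
    byCloser : ∀ o → OpenerAllowed o → OpenerFits o Γ Δ → CloserPremiss Z o k → RightJump Z Γ Δ k

  With□Zˡ : Fm → List Fm → List Fm → ℕ → Set
  With□Zˡ Z Γ Δ k = Σ (Residue Γ Δ) λ r → ResidueAllowed r × (□ Z ∷ residueˡ r ⊢[ suc k ] residueʳ r)

  WithZˡ WithZʳ : Fm → List Fm → List Fm → Set
  WithZˡ Z Γ Δ = Σ (Residue Γ Δ) λ r → ResidueAllowed r × (residueˡ r ++ Z ∷ [] ⊩ residueʳ r)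
  WithZʳ Z Γ Δ = Σ (Residue Γ Δ) λ r → ResidueAllowed r × (residueˡ r ⊩ residueʳ r ++ Z ∷ [])

  classifyLeft : ∀ {k Γ Δ Z} → isNormal L ≡ false → ∀ o c → OpenerAllowed o → CloserAllowed c
                 → OpenerFits o Γ (□ Z ∷ Δ) → CloserFits c Γ (□ Z ∷ Δ)
                 → closerˡ c ++ openerˡ o ⊢[ k ] closerʳ c ++ openerʳ o
                 → Γ ⊢[ suc k ] Δ ⊎ LeftJump Z Γ Δ k
  classifyLeft e (open□R B) (close□L A) _ _ (here refl) fc d =
    inj₂ (by□R (closer (close□L A) tt fc d) (some (close4 A) fc)
               (jumpM e (open□R B) (close□L A) tt tt (here refl) (here refl) d))
  classifyLeft e (open□R B) (close4 A) _ ac (here refl) fc d =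
    inj₂ (by□R (closer (close4 A) ac fc d) (some (close4 A) fc)
               (jumpM e (open□R B) (close4 A) tt ac (here refl) (here refl) d))
  classifyLeft e (open□R B) (close5 _) _ _ (here refl) (here refl) d =
    inj₂ (by□R (self5 d) none (jumpM e (open□R B) (close5 B) tt tt (here refl) (here refl) d))
  classifyLeft e (open□R B) (close5 A) _ _ (here refl) (there fc) d =
    inj₂ (by□R (closer (close5 A) tt fc d) (some (close5 A) fc)
               (jumpM e (open□R B) (close5 A) tt tt (here refl) (there (here refl)) d))
  classifyLeft e (open□R B) (close5 A) _ _ (there fo) (here refl) d = inj₂ (by5 (open□R B) tt fo d)
  classifyLeft e (open□R B) (close5 A) _ _ (there fo) (there fc) d = inj₁ (jumpM e (open□R B) (close5 A) tt tt fo fc d)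
  classifyLeft e (open□R B) (close□L A) _ _ (there fo) fc d = inj₁ (jumpM e (open□R B) (close□L A) tt tt fo fc d)
  classifyLeft e (open□R B) (close4 A) _ ac (there fo) fc d = inj₁ (jumpM e (open□R B) (close4 A) tt ac fo fc d)
  classifyLeft e openP (close5 A) ao _ _ (here refl) d = inj₂ (by5 openP ao tt d)
  classifyLeft e openP (close5 A) ao _ _ (there fc) d = inj₁ (jumpM e openP (close5 A) ao tt tt fc d)
  classifyLeft e openP (close□L A) ao _ _ fc d = inj₁ (jumpM e openP (close□L A) ao tt tt fc d)
  classifyLeft e openP (close4 A) ao ac _ fc d = inj₁ (jumpM e openP (close4 A) ao ac tt fc d)
  classifyLeft e (openD X) (close5 A) ao _ fo (here refl) d = inj₂ (by5 (openD X) ao fo d)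
  classifyLeft e (openD X) (close5 A) ao _ fo (there fc) d = inj₁ (jumpM e (openD X) (close5 A) ao tt fo fc d)
  classifyLeft e (openD X) (close□L A) ao _ fo fc d = inj₁ (jumpM e (openD X) (close□L A) ao tt fo fc d)
  classifyLeft e (openD X) (close4 A) ao ac fo fc d = inj₁ (jumpM e (openD X) (close4 A) ao ac fo fc d)

  classifyRight : ∀ {k Γ Δ Z} → isNormal L ≡ false → ∀ o c → OpenerAllowed o → CloserAllowed c
                  → OpenerFits o (□ Z ∷ Γ) Δ → CloserFits c (□ Z ∷ Γ) Δ
                  → closerˡ c ++ openerˡ o ⊢[ k ] closerʳ c ++ openerʳ o
                  → Γ ⊢[ suc k ] Δ ⊎ (RightJump Z Γ Δ k × With□Zˡ Z Γ Δ k)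
  classifyRight e (openD X) (close□L _) D∈ _ (here refl) (here refl) d =
    inj₂ (byD D∈ (self□L d) , none , tt , jumpM e (openD X) (close□L X) D∈ tt (here refl) (here refl) d)
  classifyRight e (openD X) (close□L A) D∈ _ (here refl) (there fc) d =
    inj₂ (byD D∈ (closer (close□L A) tt fc d) , some (close4 A) fc , D∈⇒ax4∈ D∈ ,
          jumpM e (openD X) (close□L A) D∈ tt (here refl) (there (here refl)) d)
  classifyRight e (openD X) (close4 _) D∈ ac (here refl) (here refl) d =
    inj₂ (byD D∈ (self4 ac d) , none , tt , jumpM e (openD X) (close4 X) D∈ ac (here refl) (here refl) d)
  classifyRight e (openD X) (close4 A) D∈ ac (here refl) (there fc) d =
    inj₂ (byD D∈ (closer (close4 A) ac fc d) , some (close4 A) fc , ac ,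
          jumpM e (openD X) (close4 A) D∈ ac (here refl) (there (here refl)) d)
  classifyRight e (openD X) (close5 A) D∈ _ (here refl) fc d =
    inj₂ (byD D∈ (closer (close5 A) tt fc d) , some (close5 A) fc , tt ,
          jumpM e (openD X) (close5 A) D∈ tt (here refl) (here refl) d)
  classifyRight e (openD X) (close□L A) D∈ _ (there fo) (here refl) d =
    inj₂ (byCloser (openD X) D∈ fo (by□L d) , some (close4 X) fo , D∈⇒ax4∈ D∈ ,
          jumpM e (openD X) (close□L A) D∈ tt (there (here refl)) (here refl) d)
  classifyRight e (openD X) (close□L A) D∈ _ (there fo) (there fc) d =
    inj₁ (jumpM e (openD X) (close□L A) D∈ tt fo fc d)
  classifyRight e (openD X) (close4 A) D∈ ac (there fo) (here refl) d =
    inj₂ (byCloser (openD X) D∈ fo (by4 ac d) , some (close4 X) fo , D∈⇒ax4∈ D∈ ,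
          jumpM e (openD X) (close4 A) D∈ ac (there (here refl)) (here refl) d)
  classifyRight e (openD X) (close4 A) D∈ ac (there fo) (there fc) d =
    inj₁ (jumpM e (openD X) (close4 A) D∈ ac fo fc d)
  classifyRight e (openD X) (close5 A) D∈ _ (there fo) fc d = inj₁ (jumpM e (openD X) (close5 A) D∈ tt fo fc d)
  classifyRight e (open□R B) (close□L A) _ _ fo (here refl) d =
    inj₂ (byCloser (open□R B) tt fo (by□L d) , some (close5 B) fo , tt ,
          jumpM e (open□R B) (close□L A) tt tt (here refl) (here refl) d)
  classifyRight e (open□R B) (close□L A) _ _ fo (there fc) d = inj₁ (jumpM e (open□R B) (close□L A) tt tt fo fc d)
  classifyRight e (open□R B) (close4 A) _ ac fo (here refl) d =
    inj₂ (byCloser (open□R B) tt fo (by4 ac d) , some (close5 B) fo , tt ,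
          jumpM e (open□R B) (close4 A) tt ac (here refl) (here refl) d)
  classifyRight e (open□R B) (close4 A) _ ac fo (there fc) d = inj₁ (jumpM e (open□R B) (close4 A) tt ac fo fc d)
  classifyRight e (open□R B) (close5 A) _ _ fo fc d = inj₁ (jumpM e (open□R B) (close5 A) tt tt fo fc d)
  classifyRight e openP (close□L A) P∈ _ _ (here refl) d =
    inj₂ (byCloser openP P∈ tt (by□L d) , none , tt , jumpM e openP (close□L A) P∈ tt tt (here refl) d)
  classifyRight e openP (close□L A) P∈ _ _ (there fc) d = inj₁ (jumpM e openP (close□L A) P∈ tt tt fc d)
  classifyRight e openP (close4 A) P∈ ac _ (here refl) d =
    inj₂ (byCloser openP P∈ tt (by4 ac d) , none , tt , jumpM e openP (close4 A) P∈ ac tt (here refl) d)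
  classifyRight e openP (close4 A) P∈ ac _ (there fc) d = inj₁ (jumpM e openP (close4 A) P∈ ac tt fc d)
  classifyRight e openP (close5 A) P∈ _ _ fc d = inj₁ (jumpM e openP (close5 A) P∈ tt tt fc d)

  -- Without a closer, the opener's own formula can close: by 5 for □R, by 4 for D.
  reassemble : ∀ {Γ Δ} → isNormal L ≡ false → ∀ o → OpenerAllowed o → OpenerFits o Γ Δ
               → (r : Residue Γ Δ) → ResidueAllowed r
               → residueˡ r ++ openerˡ o ⊩ residueʳ r ++ openerʳ o → Γ ⊩ Δ
  reassemble e o ao fo (some c fc) ac (n , d) = suc n , jumpM e o c ao ac fo fc d
  reassemble e (open□R B) _ fo none _ (n , d) =
    suc n , jumpM e (open□R B) (close5 B) tt tt fo fo (weaken (λ ()) there d)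
  reassemble e openP _ _ none _ (n , d) = n , weaken (λ ()) (λ ()) d
  reassemble e (openD A) D∈ fo none _ (n , d) =
    suc n , jumpM e (openD A) (close4 A) D∈ (D∈⇒ax4∈ D∈) fo fo (weaken there (λ ()) d)

  residue-in-context : ∀ {Γ Δ} (r : Residue Γ Δ)
                       → (∃ λ A → Σ (□ A ∈ Γ) λ p → r ≡ some (close□L A) p)
                         ⊎ (residueˡ r ⊆ Γ × residueʳ r ⊆ Δ)
  residue-in-context none                 = inj₂ ((λ ()) , (λ ()))
  residue-in-context (some (close□L A) p) = inj₁ (A , p , refl)
  residue-in-context (some (close4 A) p)  = inj₂ (∈-∷⁺ʳ p (λ ()) , (λ ()))
  residue-in-context (some (close5 A) p)  = inj₂ ((λ ()) , ∈-∷⁺ʳ p (λ ()))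

  -- With D, a residue □L A is turned into the opener D A.
  mergeResidues : ∀ {Γ Δ} → isNormal L ≡ false → D ∈ axioms L → (r₁ r₂ : Residue Γ Δ)
                  → ResidueAllowed r₁ → ResidueAllowed r₂
                  → residueˡ r₁ ++ residueˡ r₂ ⊩ residueʳ r₁ ++ residueʳ r₂ → Γ ⊩ Δ
  mergeResidues e D∈ r₁ r₂ a₁ a₂ d with residue-in-context r₁ | residue-in-context r₂
  ... | inj₁ (A , p , refl) | _ =
    reassemble e (openD A) D∈ p r₂ a₂
      (weaken⊩ (∈-∷⁺ʳ (∈-++⁺ʳ _ (here refl)) (xs⊆xs++ys _ _)) (xs⊆xs++ys _ _) d)
  ... | inj₂ _ | inj₁ (A , p , refl) =
    reassemble e (openD A) D∈ p r₁ a₁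
      (weaken⊩ (++-⊆ (xs⊆xs++ys _ _) (∈-∷⁺ʳ (∈-++⁺ʳ _ (here refl)) (λ ()))) ⊆-refl d)
  ... | inj₂ (s₁ , t₁) | inj₂ (s₂ , t₂) = weaken⊩ (++-⊆ s₁ s₂) (++-⊆ t₁ t₂) d

  CutAt : ℕ → ℕ → Fm → Set
  CutAt m n F = ∀ {Ξ Θ} → Ξ ⊢[ m ] F ∷ Θ → F ∷ Ξ ⊢[ n ] Θ → Ξ ⊩ Θ

  CutOn : Fm → Set
  CutOn F = ∀ {m n} → CutAt m n F

  cut-□RPremiss : ∀ {k₁ k₂ Γ Δ Z} → □RPremiss Z Γ Δ k₁ → With□Zˡ Z Γ Δ k₂ → CutAt k₁ (suc k₂) (□ Z)
                  → WithZʳ Z Γ Δ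
  cut-□RPremiss {Z = Z} (self5 d) (r , ar , dʳ) cut₁ = r , ar ,
    cut₁ {Ξ = residueˡ r} {Θ = residueʳ r ++ Z ∷ []}
         (weaken (λ ()) (∈-∷⁺ʳ (here refl) (∈-∷⁺ʳ (there (∈-++⁺ʳ _ (here refl))) (λ ()))) d)
         (weaken ⊆-refl (xs⊆xs++ys _ (Z ∷ [])) dʳ)
  cut-□RPremiss (closer c ac fc d) _ _ = some c fc , ac , (_ , weaken (⊆-reflexive (++-identityʳ _)) ⊆-refl d)

  cut-DPremiss : ∀ {k₁ k₂ Γ Δ Z} → DPremiss Z Γ Δ k₂ → (r : Residue Γ Δ)
                 → residueˡ r ⊢[ suc k₁ ] □ Z ∷ residueʳ r → CutAt (suc k₁) k₂ (□ Z) → WithZˡ Z Γ Δ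
  cut-DPremiss {Z = Z} (self4 ax4∈ d) r dˡ cut₂ = r , residueAllowed-4 ax4∈ r ,
    cut₂ {Ξ = residueˡ r ++ Z ∷ []} {Θ = residueʳ r}
         (weaken (xs⊆xs++ys _ (Z ∷ [])) ⊆-refl dˡ)
         (weaken (∈-∷⁺ʳ (here refl) (∈-∷⁺ʳ (there (∈-++⁺ʳ _ (here refl))) (λ ()))) (λ ()) d)
  cut-DPremiss (self□L d) _ _ _ = none , tt , (_ , weaken (∈-∷⁺ʳ (here refl) (∈-∷⁺ʳ (here refl) (λ ()))) (λ ()) d)
  cut-DPremiss (closer c ac fc d) _ _ _ = some c fc , ac , (_ , weaken ⊆-refl (⊆-reflexive (++-identityʳ _)) d)

  principalM : ∀ {k₁ k₂ Γ Δ Z} → isNormal L ≡ false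
               → LeftJump Z Γ Δ k₁ → RightJump Z Γ Δ k₂ → With□Zˡ Z Γ Δ k₂
               → CutAt k₁ (suc k₂) (□ Z) → CutAt (suc k₁) k₂ (□ Z) → CutOn Z → Γ ⊩ Δ
  principalM {Z = Z} e (by5 o ao fo dˡ) _ (r , ar , dʳ) cut₁ _ _ =
    reassemble e o ao fo r ar
      (cut₁ {Ξ = residueˡ r ++ openerˡ o} {Θ = residueʳ r ++ openerʳ o}
            (weaken (∈-++⁺ʳ (residueˡ r)) (∷⁺ʳ (□ Z) (∈-++⁺ʳ (residueʳ r))) dˡ)
            (weaken (∷⁺ʳ (□ Z) (xs⊆xs++ys _ (openerˡ o))) (xs⊆xs++ys _ (openerʳ o)) dʳ))
  principalM {Z = Z} e (by□R p□R rˡ dˡ) (byD D∈ pD) res cut₁ cut₂ cutZ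
    with rᵃ , aᵃ , _ , dᵃ ← cut-□RPremiss p□R res cut₁ | rᵇ , aᵇ , _ , dᵇ ← cut-DPremiss pD rˡ dˡ cut₂ =
    mergeResidues e D∈ rᵃ rᵇ aᵃ aᵇ
      (cutZ {Ξ = residueˡ rᵃ ++ residueˡ rᵇ} {Θ = residueʳ rᵃ ++ residueʳ rᵇ}
            (weaken (xs⊆xs++ys _ (residueˡ rᵇ)) (++-⊆ (there ∘ xs⊆xs++ys _ (residueʳ rᵇ)) (∈-∷⁺ʳ (here refl) (λ ()))) dᵃ)
            (weaken (++-⊆ (there ∘ ∈-++⁺ʳ (residueˡ rᵃ)) (∈-∷⁺ʳ (here refl) (λ ()))) (∈-++⁺ʳ (residueʳ rᵃ)) dᵇ))
  principalM {Z = Z} e (by□R p□R _ _) (byCloser o ao fo (by□L d)) res cut₁ _ cutZ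
    with rᵃ , aᵃ , _ , dᵃ ← cut-□RPremiss p□R res cut₁ =
    reassemble e o ao fo rᵃ aᵃ
      (cutZ {Ξ = residueˡ rᵃ ++ openerˡ o} {Θ = residueʳ rᵃ ++ openerʳ o}
            (weaken (xs⊆xs++ys _ (openerˡ o)) (++-⊆ (there ∘ xs⊆xs++ys _ (openerʳ o)) (∈-∷⁺ʳ (here refl) (λ ()))) dᵃ)
            (weaken (∷⁺ʳ Z (∈-++⁺ʳ (residueˡ rᵃ))) (∈-++⁺ʳ (residueʳ rᵃ)) d))
  principalM {Z = Z} e (by□R _ rˡ dˡ) (byCloser o ao fo (by4 ax4∈ d)) _ _ cut₂ _ =
    reassemble e o ao fo rˡ (residueAllowed-4 ax4∈ rˡ)
      (cut₂ {Ξ = residueˡ rˡ ++ openerˡ o} {Θ = residueʳ rˡ ++ openerʳ o}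
            (weaken (xs⊆xs++ys _ (openerˡ o)) (∷⁺ʳ (□ Z) (xs⊆xs++ys _ (openerʳ o))) dˡ)
            (weaken (∷⁺ʳ (□ Z) (∈-++⁺ʳ (residueˡ rˡ))) (∈-++⁺ʳ (residueʳ rˡ)) d))

  principalN : ∀ {k₁ k₂ Γ Δ Z} → isNormal L ≡ true
               → (oˡ : NormalOpener Γ (□ Z ∷ Δ)) → unbox Γ ++ boxes Γ ⊢[ k₁ ] □ Z ∷ boxes Δ ++ nopenerʳ oˡ
               → (oʳ : NormalOpener (□ Z ∷ Γ) Δ) → (Z ∷ unbox Γ) ++ □ Z ∷ boxes Γ ⊢[ k₂ ] boxes Δ ++ nopenerʳ oʳ
               → CutAt k₁ (suc k₂) (□ Z) → CutAt (suc k₁) k₂ (□ Z) → CutOn Z → Γ ⊩ Δ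
  principalN {k₁} {k₂} {Γ} {Δ} {Z} e oˡ dˡ oʳ dʳ cut₁ cut₂ cutZ = byLeft oˡ dˡ
    where
    UΓ BΓ BΔ : List Fm
    UΓ = unbox Γ
    BΓ = boxes Γ
    BΔ = boxes Δ

    □Z∷ : ∀ {Ξ Ξ′} → Ξ ⊆□ Ξ′ → □ Z ∷ Ξ ⊆□ □ Z ∷ Ξ′
    □Z∷ s (here eq) = here eq
    □Z∷ s (there p) = there (s p)

    -- The conclusion of a jump can be restricted to its boxed formulas.
    boxedʳ : □ Z ∷ BΓ ⊢[ suc k₂ ] BΔ
    boxedʳ = jumpN-⊆□ (□Z∷ (boxes-⊆□ Γ)) (boxes-⊆□ Δ) e oʳ dʳ

    cutBoxedʳ : ∀ o → UΓ ++ BΓ ⊢[ k₁ ] □ Z ∷ BΔ ++ nopenerʳ {Γ} {□ Z ∷ Δ} o → UΓ ++ BΓ ⊩ BΔ ++ nopenerʳ o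
    cutBoxedʳ o d = cut₁ d (weaken (∷⁺ʳ (□ Z) (∈-++⁺ʳ UΓ)) (xs⊆xs++ys _ (nopenerʳ o)) boxedʳ)

    close : (o : NormalOpener (□ Z ∷ Γ) Δ) → UΓ ++ BΓ ⊩ BΔ ++ nopenerʳ o → Γ ⊩ Δ
    close (nopen□R B p) (n , d) = suc n , jumpN e (nopen□R B p) d
    close (nopenD A (there p) D∈) (n , d) = suc n , jumpN e (nopenD A p D∈) d
    close (nopenD A (here refl) D∈) (n , d) with boxFree-or-box Γ
    ... | inj₁ (Y , p) = suc n , jumpN e (nopenD Y p D∈) d
    ... | inj₂ noBox   = n , weaken (no-unbox-⊆ Γ noBox) (++-⊆ (boxes⊆ Δ) (λ ())) d

    byLeft : (o : NormalOpener Γ (□ Z ∷ Δ)) → UΓ ++ BΓ ⊢[ k₁ ] □ Z ∷ BΔ ++ nopenerʳ o → Γ ⊩ Δ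
    byLeft (nopen□R B (there p)) d with n , d′ ← cutBoxedʳ (nopen□R B (there p)) d = suc n , jumpN e (nopen□R B p) d′
    byLeft (nopenD A p D∈) d with n , d′ ← cutBoxedʳ (nopenD A p D∈) d = suc n , jumpN e (nopenD A p D∈) d′
    byLeft (nopen□R _ (here refl)) d = close oʳ (cutZ (proj₂ zʳ) (proj₂ zˡ))
      where
      boxedˡ : BΓ ⊢[ suc k₁ ] □ Z ∷ BΔ
      boxedˡ = jumpN-⊆□ (boxes-⊆□ Γ) (□Z∷ (boxes-⊆□ Δ)) e (nopen□R Z (here refl)) d
      zʳ : UΓ ++ BΓ ⊩ Z ∷ BΔ ++ nopenerʳ oʳ
      zʳ = weaken⊩ ⊆-refl (++-⊆ (there ∘ xs⊆xs++ys _ _) (∈-∷⁺ʳ (here refl) (λ ())))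
                   (cutBoxedʳ (nopen□R Z (here refl)) d)
      zˡ : Z ∷ UΓ ++ BΓ ⊩ BΔ ++ nopenerʳ oʳ
      zˡ = cut₂ (weaken (there ∘ ∈-++⁺ʳ UΓ) (∷⁺ʳ (□ Z) (xs⊆xs++ys _ _)) boxedˡ)
                (weaken (∈-∷⁺ʳ (there (here refl))
                           (++-⊆ (there ∘ there ∘ xs⊆xs++ys UΓ BΓ) (∈-∷⁺ʳ (here refl) (there ∘ there ∘ ∈-++⁺ʳ UΓ))))
                        ⊆-refl dʳ)

  pastˡ-compL : ∀ {F m n Γ Δ G} → CutAt m n F → isCompound G ≡ true → G ∈ Γ
                → (∀ {q} → q ∈ leftPremisses G → proj₁ q ++ Γ ⊢[ m ] proj₂ q ++ F ∷ Δ)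
                → F ∷ Γ ⊢[ n ] Δ → Γ ⊩ Δ
  pastˡ-compL {F} cutF c G∈ ds r = compL⊩ c G∈ λ {q} i →
    cutF (weaken ⊆-refl (to-front (proj₂ q)) (ds i)) (weaken (∷⁺ʳ F (∈-++⁺ʳ (proj₁ q))) (∈-++⁺ʳ (proj₂ q)) r)

  pastˡ-compR : ∀ {F m n Γ Δ G} → CutAt m n F → isCompound G ≡ true → G ∈ Δ
                → (∀ {q} → q ∈ rightPremisses G → proj₁ q ++ Γ ⊢[ m ] proj₂ q ++ F ∷ Δ)
                → F ∷ Γ ⊢[ n ] Δ → Γ ⊩ Δ
  pastˡ-compR {F} cutF c G∈ ds r = compR⊩ c G∈ λ {q} i →
    cutF (weaken ⊆-refl (to-front (proj₂ q)) (ds i)) (weaken (∷⁺ʳ F (∈-++⁺ʳ (proj₁ q))) (∈-++⁺ʳ (proj₂ q)) r)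

  pastʳ-compL : ∀ {F m n Γ Δ G} → CutAt m n F → isCompound G ≡ true → G ∈ Γ
                → (∀ {q} → q ∈ leftPremisses G → proj₁ q ++ F ∷ Γ ⊢[ n ] proj₂ q ++ Δ)
                → Γ ⊢[ m ] F ∷ Δ → Γ ⊩ Δ
  pastʳ-compL {F} cutF c G∈ ds l = compL⊩ c G∈ λ {q} i →
    cutF (weaken (∈-++⁺ʳ (proj₁ q)) (∷⁺ʳ F (∈-++⁺ʳ (proj₂ q))) l) (weaken (to-front (proj₁ q)) ⊆-refl (ds i))

  pastʳ-compR : ∀ {F m n Γ Δ G} → CutAt m n F → isCompound G ≡ true → G ∈ Δ
                → (∀ {q} → q ∈ rightPremisses G → proj₁ q ++ F ∷ Γ ⊢[ n ] proj₂ q ++ Δ)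
                → Γ ⊢[ m ] F ∷ Δ → Γ ⊩ Δ
  pastʳ-compR {F} cutF c G∈ ds l = compR⊩ c G∈ λ {q} i →
    cutF (weaken (∈-++⁺ʳ (proj₁ q)) (∷⁺ʳ F (∈-++⁺ʳ (proj₂ q))) l) (weaken (to-front (proj₁ q)) ⊆-refl (ds i))

  cut : ∀ F m n {Γ Δ} → Γ ⊢[ m ] F ∷ Δ → F ∷ Γ ⊢[ n ] Δ → Γ ⊩ Δ

  -- The cut formula is passed whole, so that termination is seen on the heights.
  cut-jumpM : ∀ F {Z} → F ≡ □ Z → ∀ k n {Γ Δ} → isNormal L ≡ false → Γ ⊢[ suc k ] □ Z ∷ Δ → LeftJump Z Γ Δ k
              → □ Z ∷ Γ ⊢[ n ] Δ → Γ ⊩ Δ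
  cut-jumpM (□ Z) refl k _       e l jˡ (axiom (there a) b) = 0 , axiom a b
  cut-jumpM (□ Z) refl k (suc n) e l jˡ (compL () (here refl) _)
  cut-jumpM (□ Z) refl k (suc n) e l jˡ (compL c (there G∈) ds) = pastʳ-compL (cut (□ Z) (suc k) n) c G∈ ds l
  cut-jumpM (□ Z) refl k (suc n) e l jˡ (compR c G∈ ds)         = pastʳ-compR (cut (□ Z) (suc k) n) c G∈ ds l
  cut-jumpM (□ Z) refl k (suc n) e l jˡ (jumpM e′ o c ao ac fo fc d) =
    [ (λ d′ → _ , d′)
    , (λ jʳ → principalM e jˡ (proj₁ jʳ) (proj₂ jʳ)
                          (cut (□ Z) k (suc n)) (cut (□ Z) (suc k) n) (λ {m} {n} → cut Z m n))
    ]′ (classifyRight e′ o c ao ac fo fc d)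
  cut-jumpM (□ Z) refl k (suc n) e l jˡ (jumpN e′ _ _) = monotone-and-normal e e′

  cut-jumpN : ∀ F {Z} → F ≡ □ Z → ∀ k n {Γ Δ} → isNormal L ≡ true → (o : NormalOpener Γ (□ Z ∷ Δ))
              → unbox Γ ++ boxes Γ ⊢[ k ] □ Z ∷ boxes Δ ++ nopenerʳ o → □ Z ∷ Γ ⊢[ n ] Δ → Γ ⊩ Δ
  cut-jumpN (□ Z) refl k _       e o d (axiom (there a) b) = 0 , axiom a b
  cut-jumpN (□ Z) refl k (suc n) e o d (compL () (here refl) _)
  cut-jumpN (□ Z) refl k (suc n) e o d (compL c (there G∈) ds) = pastʳ-compL (cut (□ Z) (suc k) n) c G∈ ds (jumpN e o d)
  cut-jumpN (□ Z) refl k (suc n) e o d (compR c G∈ ds)         = pastʳ-compR (cut (□ Z) (suc k) n) c G∈ ds (jumpN e o d)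
  cut-jumpN (□ Z) refl k (suc n) e o d (jumpM e′ _ _ _ _ _ _ _) = monotone-and-normal e′ e
  cut-jumpN (□ Z) refl k (suc n) e o d (jumpN _ o′ d′) =
    principalN e o d o′ d′ (cut (□ Z) k (suc n)) (cut (□ Z) (suc k) n) (λ {m} {n} → cut Z m n)

  cut (var p) _ _       (axiom a (here refl)) r = _ , weaken (∈-∷⁺ʳ a ⊆-refl) ⊆-refl r
  cut (var p) _ _       (axiom a (there b))   r = 0 , axiom a b
  cut (var p) (suc m) n (compL c G∈ ds)         r = pastˡ-compL (cut (var p) m n) c G∈ ds r
  cut (var p) (suc m) n (compR () (here refl) _)   r
  cut (var p) (suc m) n (compR c (there G∈) ds) r = pastˡ-compR (cut (var p) m n) c G∈ ds r
  cut (var p) (suc m) n (jumpM e o c ao ac fo fc d) r = _ , jumpM-⊆□ id var∷-⊆□ e o c ao ac fo fc d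
  cut (var p) (suc m) n (jumpN e o d) r = _ , jumpN-⊆□ id var∷-⊆□ e o d
  cut ⊥ᶠ _ _ l r = invertʳ refl l ⊆-refl (here refl)
  cut ⊤ᶠ _ _ l r = invertˡ refl r ⊆-refl (here refl)
  cut (¬ᶠ A) _ _ l r
    with _ , dA ← invertʳ refl l ⊆-refl (here refl) | _ , d¬A ← invertˡ refl r ⊆-refl (here refl)
    = cut A _ _ d¬A dA
  cut (A ∧ᶠ B) _ _ {Γ} {Δ} l r
    with _ , lA ← invertʳ refl l ⊆-refl (here refl) | _ , lB ← invertʳ refl l ⊆-refl (there (here refl))
       | _ , rAB ← invertˡ refl r ⊆-refl (here refl)
    with _ , rA ← cut B _ _ {A ∷ Γ} (weaken there ⊆-refl lB) (weaken swap-⊆ ⊆-refl rAB)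
    = cut A _ _ lA rA
  cut (A ∨ᶠ B) _ _ {Γ} {Δ} l r
    with _ , lAB ← invertʳ refl l ⊆-refl (here refl)
       | _ , rA ← invertˡ refl r ⊆-refl (here refl) | _ , rB ← invertˡ refl r ⊆-refl (there (here refl))
    with _ , lB ← cut A _ _ {Γ} {B ∷ Δ} lAB (weaken ⊆-refl there rA)
    = cut B _ _ lB rB
  cut (A →ᶠ B) _ _ {Γ} {Δ} l r
    with _ , lAB ← invertʳ refl l ⊆-refl (here refl)
       | _ , rA ← invertˡ refl r ⊆-refl (here refl) | _ , rB ← invertˡ refl r ⊆-refl (there (here refl))
    with _ , lA ← cut B _ _ {A ∷ Γ} lAB (weaken (∷⁺ʳ B there) ⊆-refl rB)
    = cut A _ _ rA lA
  cut (□ Z) _ _       (axiom a (there b)) r = 0 , axiom a b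
  cut (□ Z) (suc m) n (compL c G∈ ds)         r = pastˡ-compL (cut (□ Z) m n) c G∈ ds r
  cut (□ Z) (suc m) n (compR () (here refl) _)   r
  cut (□ Z) (suc m) n (compR c (there G∈) ds) r = pastˡ-compR (cut (□ Z) m n) c G∈ ds r
  cut (□ Z) (suc k) n l@(jumpM e o c ao ac fo fc d) r =
    [ (λ d′ → _ , d′) , (λ jˡ → cut-jumpM (□ Z) refl k n e l jˡ r) ]′ (classifyLeft e o c ao ac fo fc d)
  cut (□ Z) (suc k) n (jumpN e o d) r = cut-jumpN (□ Z) refl k n e o d r

tag : Fm → ℕ
tag (var _)  = 0
tag ⊥ᶠ       = 1
tag ⊤ᶠ       = 2
tag (¬ᶠ _)   = 3
tag (_ ∧ᶠ _) = 4
tag (_ ∨ᶠ _) = 5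
tag (_ →ᶠ _) = 6
tag (□ _)    = 7

_≟ᶠ_ : DecidableEquality Fm

-- Off-diagonal cases are excluded by the tags.
sameTag : ∀ A B → tag A ≡ tag B → Dec (A ≡ B)
sameTag (var m)  (var n)    _ = map′ (cong var) (λ { refl → refl }) (m ℕ.≟ n)
sameTag ⊥ᶠ       ⊥ᶠ         _ = yes refl
sameTag ⊤ᶠ       ⊤ᶠ         _ = yes refl
sameTag (¬ᶠ A)   (¬ᶠ B)     _ = map′ (cong ¬ᶠ_) (λ { refl → refl }) (A ≟ᶠ B)
sameTag (A ∧ᶠ B) (A′ ∧ᶠ B′) _ =
  map′ (λ (p , q) → cong₂ _∧ᶠ_ p q) (λ { refl → refl , refl }) (A ≟ᶠ A′ ×-dec B ≟ᶠ B′)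
sameTag (A ∨ᶠ B) (A′ ∨ᶠ B′) _ =
  map′ (λ (p , q) → cong₂ _∨ᶠ_ p q) (λ { refl → refl , refl }) (A ≟ᶠ A′ ×-dec B ≟ᶠ B′)
sameTag (A →ᶠ B) (A′ →ᶠ B′) _ =
  map′ (λ (p , q) → cong₂ _→ᶠ_ p q) (λ { refl → refl , refl }) (A ≟ᶠ A′ ×-dec B ≟ᶠ B′)
sameTag (□ A)    (□ B)      _ = map′ (cong □_) (λ { refl → refl }) (A ≟ᶠ B)

A ≟ᶠ B with tag A ℕ.≟ tag B
... | yes same = sameTag A B same
... | no  diff = no (diff ∘ cong tag)

size : Fm → ℕ
size (¬ᶠ A)   = suc (size A)
size (A ∧ᶠ B) = suc (size A + size B)
size (A ∨ᶠ B) = suc (size A + size B)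
size (A →ᶠ B) = suc (size A + size B)
size _        = 1

weight : List Fm → ℕ
weight []      = 0
weight (F ∷ Γ) = size F + weight Γ

weight-++ : ∀ Γ Δ → weight (Γ ++ Δ) ≡ weight Γ + weight Δ
weight-++ []      Δ = refl
weight-++ (F ∷ Γ) Δ = trans (cong (size F +_) (weight-++ Γ Δ)) (sym (+-assoc (size F) (weight Γ) (weight Δ)))

leftPremisses-lighter : ∀ F {q} → q ∈ leftPremisses F → weight (proj₁ q) + weight (proj₂ q) < size F
leftPremisses-lighter ⊤ᶠ       (here refl)         = s≤s z≤n
leftPremisses-lighter (¬ᶠ A)   (here refl)         = s≤s (≤-reflexive (+-identityʳ (size A)))
leftPremisses-lighter (A ∧ᶠ B) (here refl)         =
  s≤s (≤-reflexive (trans (+-identityʳ _) (cong (size A +_) (+-identityʳ (size B)))))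
leftPremisses-lighter (A ∨ᶠ B) (here refl)         =
  s≤s (≤-trans (≤-reflexive (trans (+-identityʳ _) (+-identityʳ _))) (m≤m+n (size A) (size B)))
leftPremisses-lighter (A ∨ᶠ B) (there (here refl)) =
  s≤s (≤-trans (≤-reflexive (trans (+-identityʳ _) (+-identityʳ _))) (m≤n+m (size B) (size A)))
leftPremisses-lighter (A →ᶠ B) (here refl)         =
  s≤s (≤-trans (≤-reflexive (+-identityʳ _)) (m≤m+n (size A) (size B)))
leftPremisses-lighter (A →ᶠ B) (there (here refl)) =
  s≤s (≤-trans (≤-reflexive (trans (+-identityʳ _) (+-identityʳ _))) (m≤n+m (size B) (size A)))

rightPremisses-lighter : ∀ F {q} → q ∈ rightPremisses F → weight (proj₁ q) + weight (proj₂ q) < size F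
rightPremisses-lighter ⊥ᶠ       (here refl)         = s≤s z≤n
rightPremisses-lighter (¬ᶠ A)   (here refl)         =
  s≤s (≤-reflexive (trans (+-identityʳ _) (+-identityʳ _)))
rightPremisses-lighter (A ∧ᶠ B) (here refl)         =
  s≤s (≤-trans (≤-reflexive (+-identityʳ _)) (m≤m+n (size A) (size B)))
rightPremisses-lighter (A ∧ᶠ B) (there (here refl)) =
  s≤s (≤-trans (≤-reflexive (+-identityʳ _)) (m≤n+m (size B) (size A)))
rightPremisses-lighter (A ∨ᶠ B) (here refl)         =
  s≤s (≤-reflexive (cong (size A +_) (+-identityʳ (size B))))
rightPremisses-lighter (A →ᶠ B) (here refl)         =
  s≤s (≤-reflexive (cong₂ _+_ (+-identityʳ (size A)) (+-identityʳ (size B))))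

measure : List Fm → List Fm → ℕ
measure Γ Δ = weight (Γ ++ Δ)

premiss-lighter : ∀ {f} Γ Δ q n → weight (proj₁ q) + weight (proj₂ q) < f → f + measure Γ Δ < suc n
                  → measure (proj₁ q ++ Γ) (proj₂ q ++ Δ) < n
premiss-lighter {f} Γ Δ (Γ′ , Δ′) n q<f f+m< = begin-strict
  weight ((Γ′ ++ Γ) ++ Δ′ ++ Δ)                 ≡⟨ weight-++ (Γ′ ++ Γ) (Δ′ ++ Δ) ⟩
  weight (Γ′ ++ Γ) + weight (Δ′ ++ Δ)           ≡⟨ cong₂ _+_ (weight-++ Γ′ Γ) (weight-++ Δ′ Δ) ⟩
  (weight Γ′ + weight Γ) + (weight Δ′ + weight Δ) ≡⟨ interchange (weight Γ′) (weight Γ) (weight Δ′) (weight Δ) ⟩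
  (weight Γ′ + weight Δ′) + (weight Γ + weight Δ) <⟨ +-monoˡ-< (weight Γ + weight Δ) q<f ⟩
  f + (weight Γ + weight Δ)                     ≡⟨ cong (f +_) (sym (weight-++ Γ Δ)) ⟩
  f + measure Γ Δ                               ≤⟨ ≤-pred f+m< ⟩
  n                                             ∎
  where open ≤-Reasoning

atom-lighter : ∀ {F m n} → isCompound F ≡ false → size F + m < suc n → m < n
atom-lighter {var _} _ = ≤-pred
atom-lighter {□ _}   _ = ≤-pred

Holds : (Fm → Bool) → Fm → Set
Holds v F = eval v F ≡ true

infix 3 _⊨_
_⊨_ : List Fm → List Fm → Set
Γ ⊨ Δ = ∀ v → All (Holds v) Γ → Any (Holds v) Δ

⊨-mono : ∀ {Γ Γ′ Δ Δ′} → Γ ⊆ Γ′ → Δ ⊆ Δ′ → Γ ⊨ Δ → Γ′ ⊨ Δ′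
⊨-mono s t val v sat = Any-resp-⊆ t (val v (All-resp-⊇ s sat))

false-of : ∀ {v Δ F} → ¬ Any (Holds v) Δ → F ∈ Δ → eval v F ≡ false
false-of ¬any F∈ = ¬-not (¬any ∘ (λ h → lose F∈ h))

leftPremisses-sound : ∀ F v {q} → q ∈ leftPremisses F → All (Holds v) (proj₁ q) → ¬ Any (Holds v) (proj₂ q)
                      → Holds v F
leftPremisses-sound ⊤ᶠ       v (here refl)         _         _ = refl
leftPremisses-sound (¬ᶠ A)   v (here refl)         _         f rewrite false-of f (here refl) = refl
leftPremisses-sound (A ∧ᶠ B) v (here refl)         (a ∷ b ∷ []) _ rewrite a | b = refl
leftPremisses-sound (A ∨ᶠ B) v (here refl)         (a ∷ [])  _ rewrite a = refl
leftPremisses-sound (A ∨ᶠ B) v (there (here refl)) (b ∷ [])  _ rewrite b = ∨-zeroʳ (eval v A)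
leftPremisses-sound (A →ᶠ B) v (here refl)         _         f rewrite false-of f (here refl) = refl
leftPremisses-sound (A →ᶠ B) v (there (here refl)) (b ∷ [])  _ rewrite b = ∨-zeroʳ (not (eval v A))

rightPremisses-sound : ∀ F v {q} → q ∈ rightPremisses F → All (Holds v) (proj₁ q) → ¬ Any (Holds v) (proj₂ q)
                       → eval v F ≡ false
rightPremisses-sound ⊥ᶠ       v (here refl)         _        _ = refl
rightPremisses-sound (¬ᶠ A)   v (here refl)         (a ∷ []) _ rewrite a = refl
rightPremisses-sound (A ∧ᶠ B) v (here refl)         _        f rewrite false-of f (here refl) = refl
rightPremisses-sound (A ∧ᶠ B) v (there (here refl)) _        f rewrite false-of f (here refl) = ∧-zeroʳ (eval v A)
rightPremisses-sound (A ∨ᶠ B) v (here refl)         _        f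
  rewrite false-of f (here refl) | false-of f (there (here refl)) = refl
rightPremisses-sound (A →ᶠ B) v (here refl)         (a ∷ []) f rewrite a | false-of f (here refl) = refl

holds? : ∀ v Δ → Dec (Any (Holds v) Δ)
holds? v = any? (λ F → eval v F ≟ᵇ true)

leftPremiss-valid : ∀ F {q Γ Δ} → q ∈ leftPremisses F → F ∷ Γ ⊨ Δ → proj₁ q ++ Γ ⊨ proj₂ q ++ Δ
leftPremiss-valid F {q} i val v sat with holds? v (proj₂ q)
... | yes h  = Any.++⁺ˡ h
... | no  ¬h = Any.++⁺ʳ (proj₂ q)
                 (val v (leftPremisses-sound F v i (All.++⁻ˡ (proj₁ q) sat) ¬h ∷ All.++⁻ʳ (proj₁ q) sat))

rightPremiss-valid : ∀ F {q Γ Δ} → q ∈ rightPremisses F → Γ ⊨ F ∷ Δ → proj₁ q ++ Γ ⊨ proj₂ q ++ Δ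
rightPremiss-valid F {q} i val v sat with holds? v (proj₂ q)
... | yes h  = Any.++⁺ˡ h
... | no  ¬h with val v (All.++⁻ʳ (proj₁ q) sat)
...   | there h    = Any.++⁺ʳ (proj₂ q) h
...   | here holds with () ← trans (sym holds) (rightPremisses-sound F v i (All.++⁻ˡ (proj₁ q) sat) ¬h)

open DecMembership _≟ᶠ_ using (_∈?_)

membership : List Fm → Fm → Bool
membership Θ F = does (F ∈? Θ)

membership-true : ∀ Θ F → membership Θ F ≡ true → F ∈ Θ
membership-true Θ F h with F ∈? Θ
... | yes F∈ = F∈

module SequentCompleteness (L : Logic) where
  open Calculus L

  identity : ∀ A {Γ Δ} → A ∈ Γ → A ∈ Δ → Γ ⊩ Δ
  identity (var p)  a b = 0 , axiom a b
  identity ⊥ᶠ       a b = compL⊩ refl a λ ()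
  identity ⊤ᶠ       a b = compR⊩ refl b λ ()
  identity (¬ᶠ A)   a b = compR⊩ refl b λ { (here refl) → compL⊩ refl (there a) λ { (here refl) →
                           identity A (here refl) (here refl) } }
  identity (A ∧ᶠ B) a b = compR⊩ refl b λ
    { (here refl)         → compL⊩ refl a λ { (here refl) → identity A (here refl) (here refl) }
    ; (there (here refl)) → compL⊩ refl a λ { (here refl) → identity B (there (here refl)) (here refl) } }
  identity (A ∨ᶠ B) a b = compL⊩ refl a λ
    { (here refl)         → compR⊩ refl b λ { (here refl) → identity A (here refl) (here refl) }
    ; (there (here refl)) → compR⊩ refl b λ { (here refl) → identity B (here refl) (there (here refl)) } }
  identity (A →ᶠ B) a b = compR⊩ refl b λ { (here refl) → compL⊩ refl (there a) λ
    { (here refl)         → identity A (here refl) (here refl)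
    ; (there (here refl)) → identity B (here refl) (here refl) } }
  identity (□ A) {Γ} {Δ} a b with isNormal L in e
  ... | false = jumpM⊩ e (open□R A) (close□L A) tt tt b a (identity A (here refl) (here refl))
  ... | true  = jumpN⊩ e (nopen□R A b) (identity A (∈-++⁺ˡ (∈-unbox⁺ a)) (∈-++⁺ʳ (boxes Δ) (here refl)))

  Atomic : Fm → Set
  Atomic F = isCompound F ≡ false

  eval-atom : ∀ v {F} → Atomic F → eval v F ≡ v F
  eval-atom v {var _} _ = refl
  eval-atom v {□ _}   _ = refl

  -- An atomic valid sequent shares a formula between its sides: use the
  -- valuation that makes exactly the atoms on the left true.
  atomic-complete : ∀ {Θl Θr} → All Atomic Θl → All Atomic Θr → Θl ⊨ Θr → Θl ⊩ Θr
  atomic-complete {Θl} {Θr} atΘl atΘr val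
    with F , F∈Θr , F-holds ← find (val (membership Θl) (tabulate λ F∈ →
                                 trans (eval-atom _ (lookup atΘl F∈)) (dec-true (_ ∈? Θl) F∈)))
    = identity F (membership-true Θl F (trans (sym (eval-atom _ (lookup atΘr F∈Θr))) F-holds)) F∈Θr

  complete : ∀ n Θl Θr Γ Δ → measure Γ Δ < n → All Atomic Θl → All Atomic Θr
             → Θl ++ Γ ⊨ Θr ++ Δ → Θl ++ Γ ⊩ Θr ++ Δ
  complete (suc n) Θl Θr (F ∷ Γ) Δ m< atl atr val with isCompound F in c
  ... | false =
    weaken⊩ (from-front Θl) ⊆-refl
      (complete n (F ∷ Θl) Θr Γ Δ (atom-lighter c m<) (c ∷ atl) atr (⊨-mono (to-front Θl) ⊆-refl val))
  ... | true = compL⊩ c (∈-++⁺ʳ Θl (here refl)) λ {q} i →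
    weaken⊩ (premiss-⊆ Θl (proj₁ q)) (swap-++ Θr (proj₂ q) Δ)
      (complete n Θl Θr (proj₁ q ++ Γ) (proj₂ q ++ Δ) (premiss-lighter Γ Δ q n (leftPremisses-lighter F i) m<)
                atl atr
                (⊨-mono (swap-++ (proj₁ q) Θl Γ) (swap-++ (proj₂ q) Θr Δ)
                            (leftPremiss-valid F i (⊨-mono (to-front Θl) ⊆-refl val))))
  complete (suc n) Θl Θr [] (F ∷ Δ) m< atl atr val with isCompound F in c
  ... | false =
    weaken⊩ ⊆-refl (from-front Θr)
      (complete n Θl (F ∷ Θr) [] Δ (atom-lighter c m<) atl (c ∷ atr) (⊨-mono ⊆-refl (to-front Θr) val))
  ... | true = compR⊩ c (∈-++⁺ʳ Θr (here refl)) λ {q} i →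
    weaken⊩ (swap-++ Θl (proj₁ q) []) (premiss-⊆ Θr (proj₂ q))
      (complete n Θl Θr (proj₁ q ++ []) (proj₂ q ++ Δ) (premiss-lighter [] Δ q n (rightPremisses-lighter F i) m<)
                atl atr
                (⊨-mono (swap-++ (proj₁ q) Θl []) (swap-++ (proj₂ q) Θr Δ)
                            (rightPremiss-valid F i (⊨-mono ⊆-refl (to-front Θr) val))))
  complete (suc n) Θl Θr [] [] _ atl atr val =
    weaken⊩ (xs⊆xs++ys Θl []) (xs⊆xs++ys Θr [])
      (atomic-complete atl atr (⊨-mono (⊆-reflexive (++-identityʳ Θl)) (⊆-reflexive (++-identityʳ Θr)) val))

  tautology-complete : ∀ {A} → Tautology A → [] ⊩ A ∷ []
  tautology-complete {A} A-taut =
    complete (suc (size A + 0)) [] [] [] (A ∷ []) ≤-refl [] [] (λ v _ → here (A-taut v))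

  open Cut L using (cut)

  cut⊩ : ∀ {A Γ Δ} → Γ ⊩ A ∷ Δ → A ∷ Γ ⊩ Δ → Γ ⊩ Δ
  cut⊩ {A} (_ , l) (_ , r) = cut A _ _ l r

  →R⊩ : ∀ {Γ Δ A B} → A ∷ Γ ⊩ B ∷ Δ → Γ ⊩ A →ᶠ B ∷ Δ
  →R⊩ {B = B} d = compR⊩ refl (here refl) λ { (here refl) → weaken⊩ ⊆-refl (∷⁺ʳ B there) d }

  ∧R⊩ : ∀ {Γ Δ A B} → Γ ⊩ A ∷ Δ → Γ ⊩ B ∷ Δ → Γ ⊩ A ∧ᶠ B ∷ Δ
  ∧R⊩ {A = A} {B} d₁ d₂ = compR⊩ refl (here refl) λ
    { (here refl)         → weaken⊩ ⊆-refl (∷⁺ʳ A there) d₁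
    ; (there (here refl)) → weaken⊩ ⊆-refl (∷⁺ʳ B there) d₂ }

  ∨R⊩ : ∀ {Γ Δ A B} → Γ ⊩ A ∷ B ∷ Δ → Γ ⊩ A ∨ᶠ B ∷ Δ
  ∨R⊩ {A = A} {B} d = compR⊩ refl (here refl) λ { (here refl) → weaken⊩ ⊆-refl (∷⁺ʳ A (∷⁺ʳ B there)) d }

  ¬R⊩ : ∀ {Γ Δ A} → A ∷ Γ ⊩ Δ → Γ ⊩ ¬ᶠ A ∷ Δ
  ¬R⊩ d = compR⊩ refl (here refl) λ { (here refl) → weaken⊩ ⊆-refl there d }

  ∧L⊩ : ∀ {Γ Δ A B} → A ∷ B ∷ Γ ⊩ Δ → A ∧ᶠ B ∷ Γ ⊩ Δ
  ∧L⊩ {A = A} {B} d = compL⊩ refl (here refl) λ { (here refl) → weaken⊩ (∷⁺ʳ A (∷⁺ʳ B there)) ⊆-refl d }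

  □-mono⊩ : ∀ {Γ Δ A B} → A ∷ [] ⊩ B ∷ [] → □ A ∷ Γ ⊩ □ B ∷ Δ
  □-mono⊩ {Γ} {Δ} {A} {B} d with isNormal L in e
  ... | false = jumpM⊩ e (open□R B) (close□L A) tt tt (here refl) (here refl) d
  ... | true  = jumpN⊩ e (nopen□R B (here refl))
                  (weaken⊩ (∈-∷⁺ʳ (here refl) (λ ())) (∈-∷⁺ʳ (∈-++⁺ʳ (boxes (□ B ∷ Δ)) (here refl)) (λ ())) d)

  axiom⊩ : ∀ {a A} → a ∈ axioms L → AxInst a A → [] ⊩ A ∷ []
  axiom⊩ C∈ (instC A B) with isNormal L in e
  ... | false = ⊥-elim (monotone⇒C∉ e C∈)
  ... | true  = →R⊩ (∧L⊩ (jumpN⊩ e (nopen□R (A ∧ᶠ B) (here refl))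
                   (weaken⊩ (xs⊆xs++ys (A ∷ B ∷ []) _) (∈-∷⁺ʳ (there (here refl)) (λ ()))
                            (∧R⊩ {Δ = []} (identity A (here refl) (here refl))
                                          (identity B (there (here refl)) (here refl))))))
  axiom⊩ N∈ instN with isNormal L in e
  ... | false = ⊥-elim (monotone⇒N∉ e N∈)
  ... | true  = jumpN⊩ e (nopen□R ⊤ᶠ (here refl)) (compR⊩ refl (there (here refl)) λ ())
  axiom⊩ P∈ instP with isNormal L in e
  ... | false = ¬R⊩ (jumpM⊩ e openP (close□L ⊥ᶠ) P∈ tt tt (here refl) (compL⊩ refl (here refl) λ ()))
  ... | true  = ⊥-elim (normal⇒P∉ e P∈)
  axiom⊩ D∈ (instD A) with isNormal L in e
  ... | false = ¬R⊩ (∧L⊩ (jumpM⊩ e (openD A) (close□L (¬ᶠ A)) D∈ tt (here refl) (there (here refl))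
                     (compL⊩ refl (here refl) λ { (here refl) → identity A (there (here refl)) (here refl) })))
  ... | true  = ¬R⊩ (∧L⊩ (jumpN⊩ e (nopenD A (here refl) D∈)
                     (compL⊩ refl (there (here refl)) λ { (here refl) → identity A (here refl) (here refl) })))
  axiom⊩ ax4∈ (inst4 A) with isNormal L in e
  ... | false = →R⊩ (jumpM⊩ e (open□R (□ A)) (close4 A) tt ax4∈ (here refl) (here refl)
                     (identity (□ A) (here refl) (here refl)))
  ... | true  = →R⊩ (jumpN⊩ e (nopen□R (□ A) (here refl)) (identity (□ A) (there (here refl)) (there (here refl))))
  axiom⊩ _ (inst5 A) with isNormal L in e
  ... | false = ∨R⊩ (jumpM⊩ e (open□R (¬ᶠ □ A)) (close5 A) tt tt (there (here refl)) (here refl)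
                     (compR⊩ refl (there (here refl)) λ { (here refl) → identity (□ A) (here refl) (here refl) }))
  ... | true  = ∨R⊩ (jumpN⊩ e (nopen□R (¬ᶠ □ A) (there (here refl)))
                     (compR⊩ refl (there (there (here refl))) λ { (here refl) → identity (□ A) (here refl) (here refl) }))

  fromHilbert : ∀ {A} → L ⊢H A → [] ⊩ A ∷ []
  fromHilbert (taut A-taut) = tautology-complete A-taut
  fromHilbert (axM A B) =
    →R⊩ (∧R⊩ (□-mono⊩ (∧L⊩ (identity A (here refl) (here refl))))
             (□-mono⊩ (∧L⊩ (identity B (there (here refl)) (here refl)))))
  fromHilbert (ax a∈ inst) = axiom⊩ a∈ inst
  fromHilbert (mp A→B A) =
    cut⊩ (weaken⊩ ⊆-refl (∈-∷⁺ʳ (here refl) (λ ())) (fromHilbert A))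
         (invertʳ refl (proj₂ (fromHilbert A→B)) ⊆-refl (here refl))
  -- The calculus is monotone.
  fromHilbert (re A→B _) = →R⊩ (□-mono⊩ (invertʳ refl (proj₂ (fromHilbert A→B)) ⊆-refl (here refl)))

openerPrincipalˡ openerPrincipalʳ : Opener → List Fm
openerPrincipalˡ (openD A)  = □ A ∷ []
openerPrincipalˡ _          = []
openerPrincipalʳ (open□R B) = □ B ∷ []
openerPrincipalʳ _          = []

closerPrincipalˡ closerPrincipalʳ : Closer → List Fm
closerPrincipalˡ (close5 _) = []
closerPrincipalˡ (close□L A) = □ A ∷ []
closerPrincipalˡ (close4 A)  = □ A ∷ []
closerPrincipalʳ (close5 A) = □ A ∷ []
closerPrincipalʳ _          = []

module Embedding (L : Logic) where
  open Calculus L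

  infix 2 _⊢ᴸ_
  _⊢ᴸ_ : List Comp → Comp → Set
  G ⊢ᴸ c = L ⊢ str G c nothing

  exchˡ : ∀ {G Γ Γ′ Δ} → Γ ↭ Γ′ → G ⊢ᴸ Γ ⇒ Δ → G ⊢ᴸ Γ′ ⇒ Δ
  exchˡ {G} p = exch (ord (atLast G nothing)) p ↭-refl

  exchʳ : ∀ {G Γ Δ Δ′} → Δ ↭ Δ′ → G ⊢ᴸ Γ ⇒ Δ → G ⊢ᴸ Γ ⇒ Δ′
  exchʳ {G} p = exch (ord (atLast G nothing)) ↭-refl p

  to-head : ∀ {F : Fm} {Γ} → F ∈ Γ → ∃ λ Γ₀ → Γ ↭ F ∷ Γ₀
  to-head F∈ with ys , zs , refl ← ∈-∃++ F∈ = ys ++ zs , shift _ ys zs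

  absorb₁ˡ : ∀ {G F Γ Δ} → F ∈ Γ → G ⊢ᴸ F ∷ Γ ⇒ Δ → G ⊢ᴸ Γ ⇒ Δ
  absorb₁ˡ {G} {F} F∈ d with Γ₀ , Γ↭ ← to-head F∈ =
    exchˡ (↭-sym Γ↭) (ctrL (ord (atLast G nothing)) (exchˡ (↭-prep F Γ↭) d))

  absorb₁ʳ : ∀ {G F Γ Δ} → F ∈ Δ → G ⊢ᴸ Γ ⇒ F ∷ Δ → G ⊢ᴸ Γ ⇒ Δ
  absorb₁ʳ {G} {F} F∈ d with Δ₀ , Δ↭ ← to-head F∈ =
    exchʳ (↭-sym Δ↭) (ctrR (ord (atLast G nothing)) (exchʳ (↭-prep F Δ↭) d))

  absorbˡ : ∀ {G Γ Δ} X → X ⊆ Γ → G ⊢ᴸ X ++ Γ ⇒ Δ → G ⊢ᴸ Γ ⇒ Δ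
  absorbˡ []      _  d = d
  absorbˡ (F ∷ X) X⊆ d = absorbˡ X (X⊆ ∘ there) (absorb₁ˡ (∈-++⁺ʳ X (X⊆ (here refl))) d)

  absorbʳ : ∀ {G Γ Δ} X → X ⊆ Δ → G ⊢ᴸ Γ ⇒ X ++ Δ → G ⊢ᴸ Γ ⇒ Δ
  absorbʳ []      _  d = d
  absorbʳ (F ∷ X) X⊆ d = absorbʳ X (X⊆ ∘ there) (absorb₁ʳ (∈-++⁺ʳ X (X⊆ (here refl))) d)

  absorbBoxes : ∀ {G Γ Δ} → G ⊢ᴸ boxes Γ ++ boxes Γ ++ Γ ⇒ boxes Δ ++ Δ → G ⊢ᴸ Γ ⇒ Δ
  absorbBoxes {Γ = Γ} {Δ} d =
    absorbʳ (boxes Δ) (boxes⊆ Δ)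
      (absorbˡ (boxes Γ) (boxes⊆ Γ) (absorbˡ (boxes Γ) (∈-++⁺ʳ (boxes Γ) ∘ boxes⊆ Γ) d))

  applyCloser : ∀ c → CloserAllowed c → ∀ {G Γ Δ Σ Π}
                → G ++ [ Γ ⇒ Δ ] ⊢ᴸ closerˡ c ++ Σ ⇒ closerʳ c ++ Π
                → L ⊢ str G (closerPrincipalˡ c ++ Γ ⇒ closerPrincipalʳ c ++ Δ) (just (Σ ⇒ Π))
  applyCloser (close□L A) _    {G} = □L G
  applyCloser (close4 A)  ax4∈ {G} = rule4 ax4∈ G
  applyCloser (close5 A)  _    {G} = rule5 (ax5∈ L) G

  applyOpener : ∀ o → OpenerAllowed o → ∀ {G Γ Δ}
                → L ⊢ str G (Γ ⇒ Δ) (just (openerˡ o ⇒ openerʳ o))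
                → G ⊢ᴸ openerPrincipalˡ o ++ Γ ⇒ openerPrincipalʳ o ++ Δ
  applyOpener (open□R B) _  {G} = □R G
  applyOpener openP      P∈ {G} = ruleP P∈ G
  applyOpener (openD A)  D∈ {G} = ruleD D∈ G

  openerPrincipalˡ-⊆ : ∀ o {Γ Δ} → OpenerFits o Γ Δ → openerPrincipalˡ o ⊆ Γ
  openerPrincipalˡ-⊆ (openD A) fo (here refl) = fo

  openerPrincipalʳ-⊆ : ∀ o {Γ Δ} → OpenerFits o Γ Δ → openerPrincipalʳ o ⊆ Δ
  openerPrincipalʳ-⊆ (open□R B) fo (here refl) = fo

  closerPrincipalˡ-⊆ : ∀ c {Γ Δ} → CloserFits c Γ Δ → closerPrincipalˡ c ⊆ Γ
  closerPrincipalˡ-⊆ (close□L A) fc (here refl) = fc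
  closerPrincipalˡ-⊆ (close4 A)  fc (here refl) = fc

  closerPrincipalʳ-⊆ : ∀ c {Γ Δ} → CloserFits c Γ Δ → closerPrincipalʳ c ⊆ Δ
  closerPrincipalʳ-⊆ (close5 A) fc (here refl) = fc

  module Normal (normal : isNormal L ≡ true) where

    -- With C, a formula of the last component can be handed to the previous one by
    -- a closing rule, leaving the last component ordinary.
    pushˡ : (f : Fm → Fm)
            → (∀ {G Γ Δ Σ Π A} → G ++ [ Γ ⇒ Δ ] ⊢ᴸ f A ∷ Σ ⇒ Π → L ⊢ str G (□ A ∷ Γ ⇒ Δ) (just (Σ ⇒ Π)))
            → ∀ As {G Γ Δ Σ Π} → G ++ [ Γ ⇒ Δ ] ⊢ᴸ map f As ++ Σ ⇒ Π → G ++ [ map □_ As ++ Γ ⇒ Δ ] ⊢ᴸ Σ ⇒ Π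
    pushˡ f close []       d = d
    pushˡ f close (A ∷ As) {G} {Γ} {Δ} {Σ} {Π} d =
      exch (ord (inPre G [] (Σ ⇒ Π) nothing)) (shift (□ A) (map □_ As) Γ) ↭-refl
           (pushˡ f close As (ruleC (normal⇒C∈ normal) G (close d)))

    pushʳ : ∀ As {G Γ Δ Σ Π} → G ++ [ Γ ⇒ Δ ] ⊢ᴸ Σ ⇒ map □_ As ++ Π → G ++ [ Γ ⇒ map □_ As ++ Δ ] ⊢ᴸ Σ ⇒ Π
    pushʳ []       d = d
    pushʳ (A ∷ As) {G} {Γ} {Δ} {Σ} {Π} d =
      exch (ord (inPre G [] (Σ ⇒ Π) nothing)) ↭-refl (shift (□ A) (map □_ As) Δ)
           (pushʳ As (ruleC (normal⇒C∈ normal) G (rule5 (ax5∈ L) G d)))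

    pushBoxes : ∀ {G Γ Δ R} → G ++ [ Γ ⇒ Δ ] ⊢ᴸ unbox Γ ++ boxes Γ ⇒ boxes Δ ++ R
                → G ++ [ boxes Γ ++ boxes Γ ++ Γ ⇒ boxes Δ ++ Δ ] ⊢ᴸ [] ⇒ R
    pushBoxes {G} {Γ} {Δ} {R} d =
      pushʳ (unbox Δ)
        (pushˡ □_ (λ {G} → rule4 (normal⇒ax4∈ normal) G) (unbox Γ)
          (subst (λ X → G ++ [ boxes Γ ++ Γ ⇒ Δ ] ⊢ᴸ X ⇒ boxes Δ ++ R) (sym (++-identityʳ (boxes Γ)))
            (pushˡ (λ A → A) (λ {G} → □L G) (unbox Γ)
              (subst (λ X → G ++ [ Γ ⇒ Δ ] ⊢ᴸ X ++ boxes Γ ⇒ boxes Δ ++ R) (sym (map-id (unbox Γ))) d))))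

  embed : ∀ {n Γ Δ} → Γ ⊢[ n ] Δ → ∀ G → G ⊢ᴸ Γ ⇒ Δ
  embed (axiom {p = p} a b) G with Γ₀ , Γ↭ ← to-head a | Δ₀ , Δ↭ ← to-head b =
    exchˡ (↭-sym Γ↭) (exchʳ (↭-sym Δ↭) (init (atLast G nothing) p Γ₀ Δ₀))
  embed (compL {Δ = Δ} {F = ⊥ᶠ} _ F∈ _) G with Γ₀ , Γ↭ ← to-head F∈ = exchˡ (↭-sym Γ↭) (⊥L (atLast G nothing) Γ₀ Δ)
  embed (compL {F = ⊤ᶠ}     _ F∈ ds) G = embed (ds (here refl)) G
  embed (compL {F = ¬ᶠ A}   _ F∈ ds) G = absorb₁ˡ F∈ (¬L (atLast G nothing) (embed (ds (here refl)) G))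
  embed (compL {F = A ∧ᶠ B} _ F∈ ds) G = absorb₁ˡ F∈ (∧L (atLast G nothing) (embed (ds (here refl)) G))
  embed (compL {F = A ∨ᶠ B} _ F∈ ds) G =
    absorb₁ˡ F∈ (∨L (atLast G nothing) (embed (ds (here refl)) G) (embed (ds (there (here refl))) G))
  embed (compL {F = A →ᶠ B} _ F∈ ds) G =
    absorb₁ˡ F∈ (→L (atLast G nothing) (embed (ds (here refl)) G) (embed (ds (there (here refl))) G))
  embed (compR {F = ⊥ᶠ}     _ F∈ ds) G = embed (ds (here refl)) G
  embed (compR {Γ = Γ} {F = ⊤ᶠ} _ F∈ _) G with Δ₀ , Δ↭ ← to-head F∈ = exchʳ (↭-sym Δ↭) (⊤R (atLast G nothing) Γ Δ₀)
  embed (compR {F = ¬ᶠ A}   _ F∈ ds) G = absorb₁ʳ F∈ (¬R (atLast G nothing) (embed (ds (here refl)) G))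
  embed (compR {F = A ∧ᶠ B} _ F∈ ds) G =
    absorb₁ʳ F∈ (∧R (atLast G nothing) (embed (ds (here refl)) G) (embed (ds (there (here refl))) G))
  embed (compR {F = A ∨ᶠ B} _ F∈ ds) G = absorb₁ʳ F∈ (∨R (atLast G nothing) (embed (ds (here refl)) G))
  embed (compR {F = A →ᶠ B} _ F∈ ds) G = absorb₁ʳ F∈ (→R (atLast G nothing) (embed (ds (here refl)) G))
  embed {Γ = Γ} {Δ} (jumpM _ o c ao ac fo fc d) G =
    absorbʳ (closerPrincipalʳ c) (closerPrincipalʳ-⊆ c fc)
      (absorbˡ (closerPrincipalˡ c) (closerPrincipalˡ-⊆ c fc)
        (absorbʳ (openerPrincipalʳ o) (∈-++⁺ʳ (closerPrincipalʳ c) ∘ openerPrincipalʳ-⊆ o fo)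
          (absorbˡ (openerPrincipalˡ o) (∈-++⁺ʳ (closerPrincipalˡ c) ∘ openerPrincipalˡ-⊆ o fo)
            (applyOpener o ao (applyCloser c ac (embed d (G ++ [ Γ ⇒ Δ ])))))))
  embed {Γ = Γ} {Δ} (jumpN e (nopen□R B B∈) d) G =
    absorbBoxes (absorb₁ʳ (∈-++⁺ʳ (boxes Δ) B∈)
      (□R G (ruleN (normal⇒N∈ e) G (pushBoxes (embed d (G ++ [ Γ ⇒ Δ ]))))))
    where open Normal e
  embed {Γ = Γ} {Δ} (jumpN e (nopenD A A∈ D∈) d) G =
    absorbBoxes (absorb₁ˡ (∈-++⁺ʳ (boxes Γ) (∈-++⁺ʳ (boxes Γ) A∈))
      (ruleD D∈ G (ruleN (normal⇒N∈ e) G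
        (wkL (ord (atLast (G ++ [ _ ]) nothing)) (pushBoxes (embed d (G ++ [ Γ ⇒ Δ ])))))))
    where open Normal e

completeness : ∀ L {A} → L ⊢H A → L ⊢ (⇒ A)
completeness L h = Embedding.embed L (proj₂ (SequentCompleteness.fromHilbert L h)) []

soundness : ∀ L {A} → L ⊢ (⇒ A) → L ⊢H A
soundness L d with isNormal L in e
... | true  = NormalSoundness.soundness L e d
... | false = MonotoneSoundness.soundness L e d

mainTheorem14 : (L : Logic) (A : Fm) → ((L ⊢H A → L ⊢ (⇒ A)) × (L ⊢ (⇒ A) → L ⊢H A))
mainTheorem14 L A = completeness L , soundness L
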